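{- Let $n\ge1$, $R\le D_8$, and $T$ a set of tile designs for $R$. For $g\in R$ let $\mathrm{Fix}^{\mathrm{sq}}_g(n)=\sum_{(a,b)\in(\mathbb{Z}/n\mathbb{Z})^2}|X^{((a,b),g)}|$, where $X^{((a,b),g)}$ is the set of tilings of the $n\times n$ torus fixed by $((a,b),g)$. Then (for $g\in R$): $\mathrm{Fix}^{\mathrm{sq}}_{\mathrm{id}}(n)=\sum_{d_1\mid n}\sum_{d_2\mid n}\varphi(d_1)\varphi(d_2)t_{\mathrm{id}}^{n^2/\mathrm{lcm}(d_1,d_2)}$; $\mathrm{Fix}^{\mathrm{sq}}_{r^2}(n)=n^2t_{\mathrm{id}}^{(n^2-1)/2}t_{r^2}$ if $n$ odd, and $n^2\left(\tfrac34 t_{\mathrm{id}}^{n^2/2}+\tfrac14 t_{\mathrm{id}}^{n^2/2-2}t_{r^2}^4\right)$ if $n$ even; $\mathrm{Fix}^{\mathrm{sq}}_{f}(n)=n\sum_{d\mid n}\varphi(d)\left(\tfrac12 t_{\mathrm{id}}^{n^2/\mathrm{lcm}(2,d)}+\tfrac12 t_{\mathrm{id}}^{(n^2-2n)/\mathrm{lcm}(2,d)}t_{f^d}^{2n/d}\right)$ if $n$ even, and $n\sum_{d\mid n}\varphi(d)t_{\mathrm{id}}^{(n^2-n)/\mathrm{lcm}(2,d)}t_{f^d}^{n/d}$ if $n$ odd; $\mathrm{Fix}^{\mathrm{sq}}_{r^2f}(n)=n\sum_{d\mid n}\varphi(d)\left(\tfrac12 t_{\mathrm{id}}^{n^2/\mathrm{lcm}(2,d)}+\tfrac12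 t_{\mathrm{id}}^{(n^2-2n)/\mathrm{lcm}(2,d)}t_{(r^2f)^d}^{2n/d}\right)$ if $n$ even, and $n\sum_{d\mid n}\varphi(d)t_{\mathrm{id}}^{(n^2-n)/\mathrm{lcm}(2,d)}t_{(r^2f)^d}^{n/d}$ if $n$ odd. Here $\varphi$ is Euler's totient function.
   Context: Cells: $\mathbb{Z}/n\mathbb{Z}\times\mathbb{Z}/n\mathbb{Z}$. $D_8=\langle r,f\mid r^4=f^2=(rf)^2=\mathrm{id}\rangle$ acts on cells on the right, determined by $(x,y)\cdot f=(n-1-x,y)$ and $(x,y)\cdot r=(n-1-y,x)$ (so $r^2:(n-1-x,n-1-y)$, $r^2f:(x,n-1-y)$). For $(a,b)\in(\mathbb{Z}/n\mathbb{Z})^2$ and $g\in R$, $(x,y)\cdot((a,b),g)=(x+a,y+b)\cdot g$. A set of tile designs for $R$ is a finite set $T$ with a right $R$-action; $t_g=|\{d\in T:d\cdot g=d\}|$. A tiling is a map $\tau$ from cells to $T$; $\tau$ is fixed by $s=((a,b),g)$ if $\tau(c\cdot s)=\tau(c)\cdot g$ for all cells $c$. -}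

module Defs where

open import Data.Nat using (ℕ; zero; suc; _+_; _*_; _∸_; NonZero)
open import Data.Nat.DivMod using (_mod_; _/_)
open import Data.Nat.GCD using (gcd)
open import Data.Nat.Divisibility using (_∣?_)
open import Data.Nat.Properties using (_≟_)
open import Data.Bool using (Bool; true; false; T; not; _xor_; if_then_else_)
open import Data.Unit using (tt)
open import Data.Fin using (Fin; toℕ; opposite)
import Data.Fin.Properties as FinP
open import Data.Product using (_×_; _,_; uncurry)
open import Data.List using (List; []; _∷_; [_]; map; concatMap; filter; length; allFin; upTo)
open import Data.Nat.ListAction using (sum)
import Data.Vec.Functional as VF
open import Relation.Binary.PropositionalEquality using (_≡_)
open import Relation.Nullary using (Dec)

φ : ℕ → ℕ
φ d = length (filter (λ k → gcd k d ≟ 1) (upTo d))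

divisors : ℕ → List ℕ
divisors n = filter (λ d → d ∣? n) (map suc (upTo n))

Σ∣ : ℕ → (ℕ → ℕ) → ℕ
Σ∣ n f = sum (map f (divisors n))

-- Natural-number division, total (m div 0 = 0); it is only ever applied
-- to a positive divisor that divides m exactly.
_div_ : ℕ → ℕ → ℕ
m div zero = 0
m div suc k = m / suc k

-- The dihedral group D₈, element r^i f^j encoded as (i , j), i ∈ Z/4, j ∈ {0,1}

record D8 : Set where
  constructor ⟨_,_⟩
  field
    rot  : Fin 4
    flp  : Bool
open D8 public

-- f r = r⁻¹ f, hence (r^i f^j)(r^k f^l) = r^(i + (-1)^j k) f^(j+l)
_∙_ : D8 → D8 → D8
⟨ i , j ⟩ ∙ ⟨ k , l ⟩ =
  ⟨ (toℕ i + (if j then 4 ∸ toℕ k else toℕ k)) mod 4 , j xor l ⟩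

e r f r² r²f : D8
e   = ⟨ Fin.zero , false ⟩
r   = ⟨ Fin.suc Fin.zero , false ⟩
f   = ⟨ Fin.zero , true ⟩
r²  = ⟨ Fin.suc (Fin.suc Fin.zero) , false ⟩
r²f = ⟨ Fin.suc (Fin.suc Fin.zero) , true ⟩

_⁻¹ : D8 → D8
⟨ i , false ⟩ ⁻¹ = ⟨ (4 ∸ toℕ i) mod 4 , false ⟩
⟨ i , true ⟩ ⁻¹ = ⟨ i , true ⟩

pow : D8 → ℕ → D8
pow g zero = e
pow g (suc k) = pow g k ∙ g

Cell : ℕ → Set
Cell n = Fin n × Fin n

rotCell : ∀ {n} → Cell n → Cell n
rotCell (x , y) = (opposite y , x)

flipCell : ∀ {n} → Cell n → Cell n
flipCell (x , y) = (opposite x , y)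

iter : ∀ {A : Set} → ℕ → (A → A) → A → A
iter zero h a = a
iter (suc k) h a = iter k h (h a)

actCell : ∀ {n} → Cell n → D8 → Cell n
actCell c ⟨ i , false ⟩ = iter (toℕ i) rotCell c
actCell c ⟨ i , true ⟩ = flipCell (iter (toℕ i) rotCell c)

actCellS : (n : ℕ) .{{_ : NonZero n}} → Cell n → (Fin n × Fin n) → D8 → Cell n
actCellS n (x , y) (a , b) g =
  actCell ((toℕ x + toℕ a) mod n , (toℕ y + toℕ b) mod n) g

record Subgroup : Set where
  field
    mem   : D8 → Bool
    mem-e : T (mem e)
    mem-∙ : ∀ {g h} → T (mem g) → T (mem h) → T (mem (g ∙ h))
    mem-⁻¹ : ∀ {g} → T (mem g) → T (mem (g ⁻¹))
open Subgroup public

mem-pow : (R : Subgroup) {g : D8} → T (mem R g) → (k : ℕ) → T (mem R (pow g k))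
mem-pow R p zero = mem-e R
mem-pow R p (suc k) = mem-∙ R (mem-pow R p k) p

record TileSet (R : Subgroup) : Set where
  field
    size   : ℕ
    act    : Fin size → (g : D8) → T (mem R g) → Fin size
    act-e  : ∀ d → act d e (mem-e R) ≡ d
    act-∙  : ∀ d {g h} (p : T (mem R g)) (q : T (mem R h)) →
             act d (g ∙ h) (mem-∙ R p q) ≡ act (act d g p) h q
open TileSet public

tcount : {R : Subgroup} (𝒯 : TileSet R) (g : D8) → T (mem R g) → ℕ
tcount 𝒯 g p = length (filter (λ d → act 𝒯 d g p Data.Fin.≟ d) (allFin (size 𝒯)))

allFunctions : ∀ {A : Set} (k : ℕ) → List A → List (Fin k → A)
allFunctions zero xs = [ (λ ()) ]
allFunctions (suc k) xs =
  concatMap (λ x → map (λ h → x VF.∷ h) (allFunctions k xs)) xs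

Tiling : ℕ → ℕ → Set
Tiling n m = Cell n → Fin m

allTilings : (n m : ℕ) → List (Tiling n m)
allTilings n m = map uncurry (allFunctions n (allFunctions n (allFin m)))

Fixed : (n : ℕ) .{{_ : NonZero n}} {R : Subgroup} (𝒯 : TileSet R) →
        Fin n × Fin n → (g : D8) → T (mem R g) → Tiling n (size 𝒯) → Set
Fixed n 𝒯 ab g p τ = ∀ c → τ (actCellS n c ab g) ≡ act 𝒯 (τ c) g p

fixed? : (n : ℕ) .{{_ : NonZero n}} {R : Subgroup} (𝒯 : TileSet R) →
         (ab : Fin n × Fin n) (g : D8) (p : T (mem R g)) (τ : Tiling n (size 𝒯)) →
         Dec (Fixed n 𝒯 ab g p τ)
fixed? n 𝒯 ab g p τ =
  Relation.Nullary.map′ (λ h → λ { (x , y) → h x y }) (λ h x y → h (x , y))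
    (FinP.all? λ x → FinP.all? λ y →
       τ (actCellS n (x , y) ab g) Data.Fin.≟ act 𝒯 (τ (x , y)) g p)

fixCount : (n : ℕ) .{{_ : NonZero n}} {R : Subgroup} (𝒯 : TileSet R) →
           Fin n × Fin n → (g : D8) → T (mem R g) → ℕ
fixCount n 𝒯 ab g p = length (filter (fixed? n 𝒯 ab g p) (allTilings n (size 𝒯)))

FixSq : (n : ℕ) .{{_ : NonZero n}} {R : Subgroup} (𝒯 : TileSet R) →
        (g : D8) → T (mem R g) → ℕ
FixSq n 𝒯 g p =
  sum (map (λ a → sum (map (λ b → fixCount n 𝒯 (a , b) g p) (allFin n))) (allFin n))

{-# OPTIONS --safe #-}
module Submission where

-- A tiling τ fixed by s = ((a , b) , g) satisfies τ (c · s) = τ c · g, so it is determined by its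
-- values on one representative of each orbit of the cell map c ↦ c · s, and on an orbit of
-- length L that value may be any design fixed by g^L. Hence |X^s| is the product of t_{g^L}
-- over the orbits. For g = id the cell map is the translation by (a , b), all of whose orbits
-- have length lcm (ord a) (ord b). For g = f (resp. r²f) it reflects one coordinate and
-- translates the other by b (resp. a): the cells on the F mirror lines have orbits of length
-- d = ord b (resp. ord a), all others of length lcm 2 d, and F = 1 for odd n while F is 0 or 2
-- according to the parity of a (resp. b) for even n. For g = r² it is a point reflection whose
-- orbits have length 2 except at its 1 (n odd) or 0 or 4 (n even) centres. Finally, summing over
-- the translations, exactly φ d elements of ℤ/n have order d, which yields the divisor sums.

open import Defs
open import Data.Bool using (Bool; true; false; T; not; _∧_; if_then_else_)
import Data.Bool.Properties as BoolP
open import Data.Empty using (⊥-elim)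
open import Data.Fin using (Fin; zero; suc; toℕ; fromℕ<; opposite; combine)
import Data.Fin.Properties as FinP
open import Data.List using (List; []; _∷_; _++_; map; filter; length; concatMap; allFin; upTo; applyUpTo; tabulate; cartesianProduct)
open import Data.List.Membership.Propositional using (_∈_)
open import Data.List.Membership.Propositional.Properties using (∈-allFin; ∈-filter⁻; ∈-map⁻; ∈-cartesianProduct⁺)
import Data.List.Properties as ListP
open import Data.List.Relation.Unary.All using (universal)
open import Data.List.Relation.Unary.Any using (here; there)
open import Data.Nat
open import Data.Nat.Coprimality using (coprime-/gcd; coprime-divisor; coprime⇒gcd≡1)
import Data.Nat.Coprimality as Coprimality
open import Data.Nat.DivMod
  using (_/_; _%_; _mod_; %-congʳ; /-congʳ; m≡m%n+[m/n]*n; m%n<n; m<n⇒m%n≡m; m*n/n≡m; m/n*n≡m; m*[n/m]≡n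
        ; m<n*o⇒m/o<n; %-distribˡ-+; m%n%n≡m%n; [m+kn]%n≡m%n; %-remove-+ʳ; m≥n⇒m/n>0; [m∸n*o]/o≡m/o∸n)
open import Data.Nat.Divisibility
  using (_∣_; divides; _∣?_; 1∣_; ∣-refl; ∣-trans; ∣⇒≤; *-cancelˡ-∣; *-monoʳ-∣; m∣m*n; n∣m*n; ∣m+n∣m⇒∣n; ∣m∣n⇒∣m+n)
open import Data.Nat.GCD using (gcd; gcd[m,n]∣m; gcd[m,n]∣n; gcd[m,n]≢0; gcd[m,n]≤n; c*gcd[m,n]≡gcd[cm,cn])
open import Data.Nat.LCM using (lcm; lcm-least; m∣lcm[m,n]; n∣lcm[m,n]; gcd*lcm)
open import Data.Nat.ListAction using (sum; product)
import Data.Nat.ListAction.Properties as ListActionP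
open import Data.Nat.Properties
open import Data.Nat.Tactic.RingSolver using (solve-∀)
open import Data.Product using (_×_; _,_; proj₁; proj₂; ∃; uncurry)
open import Data.Product.Function.NonDependent.Propositional using (_×-⇔_)
import Data.Product.Properties as ProductP
open import Data.Sum using (_⊎_; inj₁; inj₂; [_,_]′)
open import Data.Unit using (⊤; tt)
import Data.Vec.Functional as VF
open import Function using (id; _∘_; case_of_; it; _⇔_; mk⇔; Equivalence)
import Function.Properties.Equivalence as ⇔
open import Level using (0ℓ)
open import Relation.Binary.Bundles using (DecSetoid)
open import Relation.Binary.Definitions using (tri<; tri≈; tri>)
open import Relation.Binary.PropositionalEquality
open import Relation.Binary.PropositionalEquality.Properties using (decSetoid)
open import Relation.Nullary using (¬_; Dec; yes; no; does; ¬?; _×-dec_; _⊎-dec_; _→-dec_; map′)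
open import Relation.Nullary.Decidable using (T?; dec-true; dec-false; does-⇔)
open import Relation.Unary using (Decidable; _≐_)

private variable
  U V : Set

module _ {P : Set} (P? : Dec P) {a b : U} where

  if-dec-yes : P → (if does P? then a else b) ≡ a
  if-dec-yes p = cong (if_then a else b) (dec-true P? p)

  if-dec-no : ¬ P → (if does P? then a else b) ≡ b
  if-dec-no ¬p = cong (if_then a else b) (dec-false P? ¬p)

T-does⇔ : {P : Set} (P? : Dec P) → T (does P?) ⇔ P
T-does⇔ (yes p) = mk⇔ (λ _ → p) (λ _ → tt)
T-does⇔ (no ¬p) = mk⇔ (λ ()) ¬p

T-not⇔¬T : ∀ b → T (not b) ⇔ (¬ T b)
T-not⇔¬T false = mk⇔ (λ _ ()) (λ _ → tt)
T-not⇔¬T true = mk⇔ (λ ()) (λ ¬t → ¬t tt)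

count : {P : U → Set} → Decidable P → List U → ℕ
count P? xs = length (filter P? xs)

module _ {P : U → Set} (P? : Decidable P) where

  count-none : ∀ xs → (∀ x → ¬ P x) → count P? xs ≡ 0
  count-none xs ¬P = cong length (ListP.filter-none P? (universal ¬P xs))

  count-all : ∀ xs → (∀ x → P x) → count P? xs ≡ length xs
  count-all xs allP = cong length (ListP.filter-all P? (universal allP xs))

  count-++ : ∀ xs ys → count P? (xs ++ ys) ≡ count P? xs + count P? ys
  count-++ xs ys = trans (cong length (ListP.filter-++ P? xs ys)) (ListP.length-++ (filter P? xs))

  count-map : (f : V → U) → ∀ xs → count P? (map f xs) ≡ count (P? ∘ f) xs
  count-map f [] = refl
  count-map f (x ∷ xs) with does (P? (f x))
  ... | true  = cong suc (count-map f xs)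
  ... | false = count-map f xs

  count-concatMap : (f : V → List U) → ∀ xs →
    count P? (concatMap f xs) ≡ sum (map (λ x → count P? (f x)) xs)
  count-concatMap f [] = refl
  count-concatMap f (x ∷ xs) =
    trans (count-++ (f x) (concatMap f xs)) (cong (count P? (f x) +_) (count-concatMap f xs))

  count-+-count-¬ : ∀ xs → count P? xs + count (¬? ∘ P?) xs ≡ length xs
  count-+-count-¬ [] = refl
  count-+-count-¬ (x ∷ xs) with P? x
  ... | yes _ = cong suc (count-+-count-¬ xs)
  ... | no _  = trans (+-suc _ _) (cong suc (count-+-count-¬ xs))

count-cong : {P Q : U → Set} (P? : Decidable P) (Q? : Decidable Q) → P ≐ Q →
  ∀ xs → count P? xs ≡ count Q? xs
count-cong P? Q? P≐Q xs = cong length (ListP.filter-≐ P? Q? P≐Q xs)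

count-⊎ : {P Q : U → Set} (P? : Decidable P) (Q? : Decidable Q) → (∀ x → P x → ¬ Q x) →
  ∀ xs → count (λ x → P? x ⊎-dec Q? x) xs ≡ count P? xs + count Q? xs
count-⊎ P? Q? disjoint [] = refl
count-⊎ P? Q? disjoint (x ∷ xs) with P? x | Q? x
... | yes p | yes q = ⊥-elim (disjoint x p q)
... | yes _ | no _  = cong suc (count-⊎ P? Q? disjoint xs)
... | no _  | yes _ = trans (cong suc (count-⊎ P? Q? disjoint xs)) (sym (+-suc _ _))
... | no _  | no _  = count-⊎ P? Q? disjoint xs

count-filter-⊆ : {P Q : U → Set} (P? : Decidable P) (Q? : Decidable Q) → (∀ {x} → P x → Q x) →
  ∀ xs → count P? (filter Q? xs) ≡ count P? xs
count-filter-⊆ P? Q? P⊆Q [] = refl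
count-filter-⊆ P? Q? P⊆Q (x ∷ xs) with Q? x
... | yes _ with P? x
...   | yes _ = cong suc (count-filter-⊆ P? Q? P⊆Q xs)
...   | no _  = count-filter-⊆ P? Q? P⊆Q xs
count-filter-⊆ P? Q? P⊆Q (x ∷ xs) | no ¬q with P? x
...   | yes p = ⊥-elim (¬q (P⊆Q p))
...   | no _  = count-filter-⊆ P? Q? P⊆Q xs

indicator : {P : U → Set} → Decidable P → U → ℕ
indicator P? x = if does (P? x) then 1 else 0

count≡sum-indicator : {P : U → Set} (P? : Decidable P) → ∀ xs → count P? xs ≡ sum (map (indicator P?) xs)
count≡sum-indicator P? [] = refl
count≡sum-indicator P? (x ∷ xs) with does (P? x)
... | true  = cong suc (count≡sum-indicator P? xs)
... | false = count≡sum-indicator P? xs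

sum-map-cong : {f g : U → ℕ} → (∀ x → f x ≡ g x) → ∀ xs → sum (map f xs) ≡ sum (map g xs)
sum-map-cong f≗g xs = cong sum (ListP.map-cong f≗g xs)

sum-map-cong-∈ : {f g : U → ℕ} → ∀ xs → (∀ x → x ∈ xs → f x ≡ g x) → sum (map f xs) ≡ sum (map g xs)
sum-map-cong-∈ [] _ = refl
sum-map-cong-∈ (x ∷ xs) f≗g = cong₂ _+_ (f≗g x (here refl)) (sum-map-cong-∈ xs (λ y y∈ → f≗g y (there y∈)))

sum-map-+ : (f g : U → ℕ) → ∀ xs → sum (map (λ x → f x + g x) xs) ≡ sum (map f xs) + sum (map g xs)
sum-map-+ f g [] = refl
sum-map-+ f g (x ∷ xs) = trans (cong (f x + g x +_) (sum-map-+ f g xs)) (interchange (f x) (g x) _ _)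
  where
  interchange : ∀ a b c d → a + b + (c + d) ≡ a + c + (b + d)
  interchange = solve-∀

sum-map-*ˡ : (c : ℕ) (f : U → ℕ) → ∀ xs → sum (map (λ x → c * f x) xs) ≡ c * sum (map f xs)
sum-map-*ˡ c f [] = sym (*-zeroʳ c)
sum-map-*ˡ c f (x ∷ xs) = trans (cong (c * f x +_) (sum-map-*ˡ c f xs)) (sym (*-distribˡ-+ c (f x) _))

sum-map-const : (c : ℕ) → ∀ (xs : List U) → sum (map (λ _ → c) xs) ≡ length xs * c
sum-map-const c [] = refl
sum-map-const c (x ∷ xs) = cong (c +_) (sum-map-const c xs)

sum-map-comm : (f : U → V → ℕ) → ∀ xs ys →
  sum (map (λ x → sum (map (f x) ys)) xs) ≡ sum (map (λ y → sum (map (λ x → f x y) xs)) ys)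
sum-map-comm f [] ys = sym (trans (sum-map-const 0 ys) (*-zeroʳ (length ys)))
sum-map-comm f (x ∷ xs) ys = trans (cong (sum (map (f x) ys) +_) (sum-map-comm f xs ys))
  (sym (sum-map-+ (f x) (λ y → sum (map (λ x → f x y) xs)) ys))

sum-map-indicator : {P : U → Set} (P? : Decidable P) (c : ℕ) (g : U → ℕ) →
  (∀ x → P x → g x ≡ c) → (∀ x → ¬ P x → g x ≡ 0) → ∀ xs → sum (map g xs) ≡ count P? xs * c
sum-map-indicator P? c g gP g¬P [] = refl
sum-map-indicator P? c g gP g¬P (x ∷ xs) with P? x
... | yes p = cong₂ _+_ (gP x p) (sum-map-indicator P? c g gP g¬P xs)
... | no ¬p = cong₂ _+_ (g¬P x ¬p) (sum-map-indicator P? c g gP g¬P xs)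

product-map-cong : {f g : U → ℕ} → (∀ x → f x ≡ g x) → ∀ xs → product (map f xs) ≡ product (map g xs)
product-map-cong f≗g xs = cong product (ListP.map-cong f≗g xs)

product-map-* : (f g : U → ℕ) → ∀ xs →
  product (map (λ x → f x * g x) xs) ≡ product (map f xs) * product (map g xs)
product-map-* f g [] = refl
product-map-* f g (x ∷ xs) = trans (cong (f x * g x *_) (product-map-* f g xs)) (interchange (f x) (g x) _ _)
  where
  interchange : ∀ a b c d → a * b * (c * d) ≡ a * c * (b * d)
  interchange = solve-∀

product-map-indicator : {P : U → Set} (P? : Decidable P) (c : ℕ) → ∀ xs →
  product (map (λ x → if does (P? x) then c else 1) xs) ≡ c ^ count P? xs
product-map-indicator P? c [] = refl
product-map-indicator P? c (x ∷ xs) with does (P? x)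
... | true  = cong (c *_) (product-map-indicator P? c xs)
... | false = trans (+-identityʳ _) (product-map-indicator P? c xs)

product-map-zero : (f : U → ℕ) {x : U} {xs : List U} → x ∈ xs → f x ≡ 0 → product (map f xs) ≡ 0
product-map-zero f {xs = y ∷ ys} (here refl) fx≡0 = cong (_* product (map f ys)) fx≡0
product-map-zero f {xs = y ∷ ys} (there x∈) fx≡0 =
  trans (cong (f y *_) (product-map-zero f x∈ fx≡0)) (*-zeroʳ (f y))

product-map-one : ∀ (xs : List U) → product (map (λ _ → 1) xs) ≡ 1
product-map-one [] = refl
product-map-one (x ∷ xs) = trans (+-identityʳ _) (product-map-one xs)

length-allFin : ∀ k → length (allFin k) ≡ k
length-allFin k = ListP.length-tabulate id

allFin-suc : ∀ k → allFin (suc k) ≡ zero ∷ map suc (allFin k)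
allFin-suc k = cong (zero ∷_) (sym (ListP.map-tabulate id suc))

map-allFin-suc : ∀ {k} (f : Fin (suc k) → U) → map f (allFin (suc k)) ≡ f zero ∷ map (f ∘ suc) (allFin k)
map-allFin-suc {k = k} f = trans (cong (map f) (allFin-suc k)) (cong (f zero ∷_) (sym (ListP.map-∘ (allFin k))))

count-allFin-≡ : ∀ {k} (i : Fin k) → count (FinP._≟ i) (allFin k) ≡ 1
count-allFin-≡ {suc k} i = trans (cong (count (FinP._≟ i)) (allFin-suc k)) (count-zero∷map-suc i)
  where
  count-zero∷map-suc : (i : Fin (suc k)) → count (FinP._≟ i) (zero ∷ map suc (allFin k)) ≡ 1
  count-zero∷map-suc zero = cong suc (trans (count-map (FinP._≟ zero) suc (allFin k)) (count-none _ (allFin k) (λ _ ())))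
  count-zero∷map-suc (suc i) = trans (count-map (FinP._≟ suc i) suc (allFin k))
    (trans (count-cong _ (FinP._≟ i) (FinP.suc-injective , cong suc) (allFin k)) (count-allFin-≡ i))

module _ {P : U × V → Set} (P? : Decidable P) where

  count-cartesianProduct : ∀ xs ys →
    count P? (cartesianProduct xs ys) ≡ sum (map (λ x → count (λ y → P? (x , y)) ys) xs)
  count-cartesianProduct [] ys = refl
  count-cartesianProduct (x ∷ xs) ys = trans (count-++ P? (map (x ,_) ys) (cartesianProduct xs ys))
    (cong₂ _+_ (count-map P? (x ,_) ys) (count-cartesianProduct xs ys))

count-cartesianProduct-× : {P : U → Set} {Q : V → Set} (P? : Decidable P) (Q? : Decidable Q) → ∀ xs ys →
  count (λ xy → P? (proj₁ xy) ×-dec Q? (proj₂ xy)) (cartesianProduct xs ys) ≡ count P? xs * count Q? ys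
count-cartesianProduct-× P? Q? xs ys = trans (count-cartesianProduct _ xs ys)
  (sum-map-indicator P? (count Q? ys) _
    (λ x p → count-cong _ Q? (proj₂ , (p ,_)) ys)
    (λ x ¬p → count-none _ ys (λ y pq → ¬p (proj₁ pq))) xs)

count-cartesianProduct-≡ : (_≟A_ : (x y : U) → Dec (x ≡ y)) (_≟B_ : (x y : V) → Dec (x ≡ y)) → ∀ {a b} xs ys →
  count (λ xy → ProductP.≡-dec _≟A_ _≟B_ xy (a , b)) (cartesianProduct xs ys) ≡ count (_≟A a) xs * count (_≟B b) ys
count-cartesianProduct-≡ _≟A_ _≟B_ {a} {b} xs ys = trans
  (count-cong _ (λ xy → (proj₁ xy ≟A a) ×-dec (proj₂ xy ≟B b)) (ProductP.×-≡,≡←≡ , ProductP.×-≡,≡→≡)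
    (cartesianProduct xs ys))
  (count-cartesianProduct-× (_≟A a) (_≟B b) xs ys)

product-cartesianProduct : (w : U × V → ℕ) → ∀ xs ys →
  product (map w (cartesianProduct xs ys)) ≡ product (map (λ x → product (map (λ y → w (x , y)) ys)) xs)
product-cartesianProduct w [] ys = refl
product-cartesianProduct w (x ∷ xs) ys = begin
  product (map w (map (x ,_) ys ++ cartesianProduct xs ys))
    ≡⟨ cong product (ListP.map-++ w (map (x ,_) ys) _) ⟩
  product (map w (map (x ,_) ys) ++ map w (cartesianProduct xs ys))
    ≡⟨ ListActionP.product-++ (map w (map (x ,_) ys)) _ ⟩
  product (map w (map (x ,_) ys)) * product (map w (cartesianProduct xs ys))
    ≡⟨ cong₂ _*_ (cong product (sym (ListP.map-∘ ys))) (product-cartesianProduct w xs ys) ⟩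
  product (map (λ y → w (x , y)) ys) * product (map (λ x → product (map (λ y → w (x , y)) ys)) xs) ∎
  where open ≡-Reasoning

length-cartesianProduct : ∀ (xs : List U) (ys : List V) → length (cartesianProduct xs ys) ≡ length xs * length ys
length-cartesianProduct [] ys = refl
length-cartesianProduct (x ∷ xs) ys = trans (ListP.length-++ (map (x ,_) ys))
  (cong₂ _+_ (ListP.length-map (x ,_) ys) (length-cartesianProduct xs ys))

Enumerates : (S : DecSetoid 0ℓ 0ℓ) → (DecSetoid.Carrier S → Set) → List (DecSetoid.Carrier S) → Set
Enumerates S P xs = ∀ x → P x → count (λ y → DecSetoid._≟_ S y x) xs ≡ 1

-- Double counting of the graph { (a , b) : P a × Φ a ≈ b } of a bijection between
-- the P-elements of xs and the Q-elements of ys, both taken up to setoid equality.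
module CountBijection (SA SB : DecSetoid 0ℓ 0ℓ) where
  private
    module SA = DecSetoid SA
    module SB = DecSetoid SB

  module _ {P : SA.Carrier → Set} {Q : SB.Carrier → Set} (P? : Decidable P) (Q? : Decidable Q)
    (P-resp : ∀ {a a'} → a' SA.≈ a → P a → P a') (Q-resp : ∀ {b b'} → b' SB.≈ b → Q b → Q b')
    (xs : List SA.Carrier) (ys : List SB.Carrier) (enum-xs : Enumerates SA P xs) (enum-ys : Enumerates SB Q ys)
    (Φ : SA.Carrier → SB.Carrier) (Ψ : SB.Carrier → SA.Carrier)
    (Φ-cong : ∀ {a a'} → a' SA.≈ a → Φ a' SB.≈ Φ a) (Ψ-cong : ∀ {b b'} → b' SB.≈ b → Ψ b' SA.≈ Ψ b)
    (Φ-Q : ∀ a → P a → Q (Φ a)) (Ψ-P : ∀ b → Q b → P (Ψ b))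
    (Ψ∘Φ : ∀ a → P a → Ψ (Φ a) SA.≈ a) (Φ∘Ψ : ∀ b → Q b → Φ (Ψ b) SB.≈ b) where

    private
      graph? : ∀ a b → Dec (P a × Φ a SB.≈ b)
      graph? a b = P? a ×-dec (Φ a SB.≟ b)

      row : ∀ a → indicator P? a ≡ count (graph? a) ys
      row a with P? a
      ... | yes p = sym (trans (count-cong _ (λ b → b SB.≟ Φ a) ((λ g → SB.sym (proj₂ g)) , (λ e → p , SB.sym e)) ys)
                               (enum-ys (Φ a) (Φ-Q a p)))
      ... | no ¬p = sym (count-none _ ys (λ b g → ¬p (proj₁ g)))

      column : ∀ b → count (λ a → graph? a b) xs ≡ indicator Q? b
      column b with Q? b
      ... | yes q = trans
        (count-cong _ (λ a → a SA.≟ Ψ b)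
          ((λ {a} g → SA.trans (SA.sym (Ψ∘Φ a (proj₁ g))) (Ψ-cong (proj₂ g)))
          , (λ e → P-resp e (Ψ-P b q) , SB.trans (Φ-cong e) (Φ∘Ψ b q))) xs)
        (enum-xs (Ψ b) (Ψ-P b q))
      ... | no ¬q = count-none _ xs (λ a g → ¬q (Q-resp (SB.sym (proj₂ g)) (Φ-Q a (proj₁ g))))

    count-≡ : count P? xs ≡ count Q? ys
    count-≡ = begin
      count P? xs
        ≡⟨ count≡sum-indicator P? xs ⟩
      sum (map (indicator P?) xs)
        ≡⟨ sum-map-cong (λ a → trans (row a) (count≡sum-indicator (graph? a) ys)) xs ⟩
      sum (map (λ a → sum (map (λ b → indicator (graph? a) b) ys)) xs)
        ≡⟨ sum-map-comm (λ a b → indicator (graph? a) b) xs ys ⟩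
      sum (map (λ b → sum (map (λ a → indicator (graph? a) b) xs)) ys)
        ≡⟨ sum-map-cong (λ b → trans (sym (count≡sum-indicator (λ a → graph? a b) xs)) (column b)) ys ⟩
      sum (map (indicator Q?) ys)
        ≡⟨ count≡sum-indicator Q? ys ⟨
      count Q? ys ∎
      where open ≡-Reasoning

count-allFunctions : ∀ k (xs : List U) {P : Fin k → U → Set} (P? : ∀ i → Decidable (P i))
  {Q : (Fin k → U) → Set} (Q? : Decidable Q) → (∀ h → Q h ⇔ (∀ i → P i (h i))) →
  count Q? (allFunctions k xs) ≡ product (map (λ i → count (P? i) xs) (allFin k))
count-allFunctions zero xs P? {Q} Q? Q⇔ = count-singleton (λ ())
  where
  count-singleton : ∀ h → count Q? (h ∷ []) ≡ 1
  count-singleton h with Q? h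
  ... | yes _ = refl
  ... | no ¬q = ⊥-elim (¬q (Equivalence.from (Q⇔ h) (λ ())))
count-allFunctions (suc k) xs {P} P? Q? Q⇔ = begin
  count Q? (allFunctions (suc k) xs)
    ≡⟨ count-concatMap Q? _ xs ⟩
  sum (map (λ x → count Q? (map (x VF.∷_) (allFunctions k xs))) xs)
    ≡⟨ sum-map-cong (λ x → count-map Q? (x VF.∷_) (allFunctions k xs)) xs ⟩
  sum (map (λ x → count (Q? ∘ (x VF.∷_)) (allFunctions k xs)) xs)
    ≡⟨ sum-map-indicator (P? zero) rest _ head-ok head-bad xs ⟩
  count (P? zero) xs * rest
    ≡⟨ cong product (map-allFin-suc (λ i → count (P? i) xs)) ⟨
  product (map (λ i → count (P? i) xs) (allFin (suc k))) ∎
  where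
  open ≡-Reasoning
  rest = product (map (λ i → count (P? (suc i)) xs) (allFin k))
  head-ok : ∀ x → P zero x → count (Q? ∘ (x VF.∷_)) (allFunctions k xs) ≡ rest
  head-ok x p = count-allFunctions k xs (P? ∘ suc) (Q? ∘ (x VF.∷_)) λ h → mk⇔
    (λ q i → Equivalence.to (Q⇔ (x VF.∷ h)) q (suc i))
    (λ ps → Equivalence.from (Q⇔ (x VF.∷ h)) λ { zero → p ; (suc i) → ps i })
  head-bad : ∀ x → ¬ P zero x → count (Q? ∘ (x VF.∷_)) (allFunctions k xs) ≡ 0
  head-bad x ¬p = count-none _ (allFunctions k xs) (λ h q → ¬p (Equivalence.to (Q⇔ (x VF.∷ h)) q zero))

iter-+ : (h : U → U) (k j : ℕ) (x : U) → iter (k + j) h x ≡ iter j h (iter k h x)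
iter-+ h zero j x = refl
iter-+ h (suc k) j x = iter-+ h k j (h x)

iter-suc : (h : U → U) (k : ℕ) (x : U) → iter (suc k) h x ≡ h (iter k h x)
iter-suc h zero x = refl
iter-suc h (suc k) x = iter-suc h k (h x)

iter-comm : (h : U → U) (i j : ℕ) (x : U) → iter i h (iter j h x) ≡ iter j h (iter i h x)
iter-comm h i j x = trans (sym (iter-+ h j i x)) (trans (cong (λ k → iter k h x) (+-comm j i)) (iter-+ h i j x))

iter-cong : {h h′ : U → U} → (∀ x → h x ≡ h′ x) → ∀ k x → iter k h x ≡ iter k h′ x
iter-cong h≗h′ zero x = refl
iter-cong {h = h} h≗h′ (suc k) x = trans (cong (iter k h) (h≗h′ x)) (iter-cong h≗h′ k _)

iter-× : (h : U → U) (h′ : V → V) (k : ℕ) (x : U) (y : V) →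
  iter k (λ (u , v) → h u , h′ v) (x , y) ≡ (iter k h x , iter k h′ y)
iter-× h h′ zero x y = refl
iter-× h h′ (suc k) x y = iter-× h h′ k (h x) (h′ y)

iter-*-periodic : (h : U → U) (L : ℕ) {x : U} → iter L h x ≡ x → ∀ q → iter (q * L) h x ≡ x
iter-*-periodic h L fix zero = refl
iter-*-periodic h L {x} fix (suc q) =
  trans (iter-+ h L (q * L) x) (trans (cong (iter (q * L) h) fix) (iter-*-periodic h L fix q))

iter-∣-periodic : (h : U → U) {L k : ℕ} {x : U} → iter L h x ≡ x → L ∣ k → iter k h x ≡ x
iter-∣-periodic h {L} fix (divides q refl) = iter-*-periodic h L fix q

iter-%-periodic : (h : U → U) (L : ℕ) .{{_ : NonZero L}} {x : U} → iter L h x ≡ x →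
  ∀ k → iter k h x ≡ iter (k % L) h x
iter-%-periodic h L {x} fix k = begin
  iter k h x                          ≡⟨ cong (λ i → iter i h x) (m≡m%n+[m/n]*n k L) ⟩
  iter (k % L + k / L * L) h x        ≡⟨ iter-+ h (k % L) (k / L * L) x ⟩
  iter (k / L * L) h (iter (k % L) h x) ≡⟨ iter-comm h (k / L * L) (k % L) x ⟩
  iter (k % L) h (iter (k / L * L) h x) ≡⟨ cong (iter (k % L) h) (iter-*-periodic h L fix (k / L)) ⟩
  iter (k % L) h x                    ∎
  where open ≡-Reasoning

even-or-odd : ∀ k → ∃ (λ h → k ≡ h + h) ⊎ ∃ (λ h → k ≡ suc (h + h))
even-or-odd zero = inj₁ (0 , refl)
even-or-odd (suc k) with even-or-odd k
... | inj₁ (h , k≡h+h) = inj₂ (h , cong suc k≡h+h)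
... | inj₂ (h , k≡1+h+h) = inj₁ (suc h , trans (cong suc k≡1+h+h) (cong suc (sym (+-suc h h))))

2∣h+h : ∀ h → 2 ∣ h + h
2∣h+h h = divides h (trans (cong (h +_) (sym (+-identityʳ h))) (*-comm 2 h))

odd≢even : ∀ p q → suc (p + p) ≢ q + q
odd≢even p q eq = even≢odd q p (trans (double q) (trans (sym eq) (cong suc (sym (double p)))))
  where
  double : ∀ h → 2 * h ≡ h + h
  double h = cong (h +_) (+-identityʳ h)

¬2∣odd : ∀ h → ¬ (2 ∣ suc (h + h))
¬2∣odd h (divides q eq) = odd≢even h q (trans eq (trans (*-comm q 2) (cong (q +_) (+-identityʳ q))))

module _ (h : U → U) (h-involutive : ∀ x → h (h x) ≡ x) (x : U) where

  private
    iter-involution : ∀ k → (∃ (λ q → k ≡ q + q) × iter k h x ≡ x)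
                          ⊎ (∃ (λ q → k ≡ suc (q + q)) × iter k h x ≡ h x)
    iter-involution zero = inj₁ ((0 , refl) , refl)
    iter-involution (suc k) with iter-involution k
    ... | inj₁ ((q , k≡) , it) = inj₂ ((q , cong suc k≡) , trans (iter-suc h k x) (cong h it))
    ... | inj₂ ((q , k≡) , it) = inj₁ ((suc q , trans (cong suc k≡) (cong suc (sym (+-suc q q))))
                                      , trans (iter-suc h k x) (trans (cong h it) (h-involutive x)))

  iter-involution-fixed : ∀ k → iter k h x ≡ x ⇔ (2 ∣ k ⊎ h x ≡ x)
  iter-involution-fixed k = mk⇔ to from
    where
    to : iter k h x ≡ x → 2 ∣ k ⊎ h x ≡ x
    to fix with iter-involution k
    ... | inj₁ ((q , k≡) , _) = inj₁ (subst (2 ∣_) (sym k≡) (2∣h+h q))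
    ... | inj₂ (_ , it) = inj₂ (trans (sym it) fix)
    from : 2 ∣ k ⊎ h x ≡ x → iter k h x ≡ x
    from 2∣k⊎fix with iter-involution k | 2∣k⊎fix
    ... | inj₁ (_ , it) | _ = it
    ... | inj₂ ((q , k≡) , _) | inj₁ 2∣k = ⊥-elim (¬2∣odd q (subst (2 ∣_) k≡ 2∣k))
    ... | inj₂ (_ , it) | inj₂ fix = trans it fix

involution-fixed-σ : (h : U → U) → (∀ x → h (h x) ≡ x) → ∀ x → h (h x) ≡ h x ⇔ h x ≡ x
involution-fixed-σ h h-involutive x = mk⇔ (λ eq → sym (trans (sym (h-involutive x)) eq)) (λ eq → trans (h-involutive x) (sym eq))

argmin : (ℕ → ℕ) → ℕ → ℕ
argmin f zero = 0
argmin f (suc l) with f (suc l) <? f (argmin f l)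
... | yes _ = suc l
... | no _  = argmin f l

argmin-minimal : (f : ℕ → ℕ) {l k : ℕ} → k ≤ l → f (argmin f l) ≤ f k
argmin-minimal f {zero} z≤n = ≤-refl
argmin-minimal f {suc l} {k} k≤1+l with f (suc l) <? f (argmin f l) | m≤n⇒m<n∨m≡n {k} {suc l} k≤1+l
... | yes lt | inj₁ (s≤s k≤l) = ≤-trans (<⇒≤ lt) (argmin-minimal f k≤l)
... | yes _  | inj₂ refl      = ≤-refl
... | no _   | inj₁ (s≤s k≤l) = argmin-minimal f k≤l
... | no ¬lt | inj₂ refl      = ≮⇒≥ ¬lt

-- Orbits of a permutation of finite order

module Orbits {X : Set} (idx : X → ℕ) (idx-injective : ∀ {x y} → idx x ≡ idx y → x ≡ y)
  (σ : X → X) (period : X → ℕ) (period-nonZero : ∀ x → NonZero (period x))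
  (iter-≡⇔period-∣ : ∀ x k → iter k σ x ≡ x ⇔ period x ∣ k) where

  private instance
    period-nonZero′ : ∀ {x} → NonZero (period x)
    period-nonZero′ {x} = period-nonZero x

  _≟X_ : (x y : X) → Dec (x ≡ y)
  x ≟X y = map′ idx-injective (cong idx) (idx x ≟ idx y)

  iter-period : ∀ x → iter (period x) σ x ≡ x
  iter-period x = Equivalence.from (iter-≡⇔period-∣ x (period x)) ∣-refl

  iter-% : ∀ x k → iter k σ x ≡ iter (k % period x) σ x
  iter-% x k = iter-%-periodic σ (period x) (iter-period x) k

  σ-injective : ∀ {x y} → σ x ≡ σ y → x ≡ y
  σ-injective {x} {y} σx≡σy = begin
    x                 ≡⟨ iter-∣-periodic σ (iter-period x) (subst (period x ∣_) (sym suc-k≡) (n∣m*n (period y))) ⟨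
    iter (suc k) σ x  ≡⟨ cong (iter k σ) σx≡σy ⟩
    iter (suc k) σ y  ≡⟨ iter-∣-periodic σ (iter-period y) (subst (period y ∣_) (sym suc-k≡) (m∣m*n (period x))) ⟩
    y                 ∎
    where
    open ≡-Reasoning
    k = pred (period y * period x)
    suc-k≡ : suc k ≡ period y * period x
    suc-k≡ = suc-pred (period y * period x) {{m*n≢0 (period y) (period x)}}

  iter-injective : ∀ j {x y} → iter j σ x ≡ iter j σ y → x ≡ y
  iter-injective zero eq = eq
  iter-injective (suc j) eq = σ-injective (iter-injective j eq)

  private
    iter-≡⇒≡-≤ : ∀ x {p q} → p ≤ q → q < period x → iter p σ x ≡ iter q σ x → p ≡ q
    iter-≡⇒≡-≤ x {p} {q} p≤q q<L eq = sym (trans (sym (m+[n∸m]≡n p≤q)) (trans (cong (p +_) d≡0) (+-identityʳ p)))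
      where
      d = q ∸ p
      σᵈ-fixes : iter d σ x ≡ x
      σᵈ-fixes = iter-injective p (begin
        iter p σ (iter d σ x) ≡⟨ iter-comm σ p d x ⟩
        iter d σ (iter p σ x) ≡⟨ iter-+ σ p d x ⟨
        iter (p + d) σ x      ≡⟨ cong (λ i → iter i σ x) (m+[n∸m]≡n p≤q) ⟩
        iter q σ x            ≡⟨ eq ⟨
        iter p σ x            ∎)
        where open ≡-Reasoning
      d≡0 : d ≡ 0
      d≡0 with d | Equivalence.to (iter-≡⇔period-∣ x d) σᵈ-fixes | ≤-<-trans (m∸n≤m q p) q<L
      ... | zero  | _   | _   = refl
      ... | suc _ | L∣d | d<L = ⊥-elim (<⇒≱ d<L (∣⇒≤ L∣d))

  iter-≡⇒≡ : ∀ x {p q} → p < period x → q < period x → iter p σ x ≡ iter q σ x → p ≡ q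
  iter-≡⇒≡ x {p} {q} p<L q<L eq with ≤-total p q
  ... | inj₁ p≤q = iter-≡⇒≡-≤ x p≤q q<L eq
  ... | inj₂ q≤p = sym (iter-≡⇒≡-≤ x q≤p p<L (sym eq))

  iter-≡⇒%-≡ : ∀ x {p q} → iter p σ x ≡ iter q σ x → p % period x ≡ q % period x
  iter-≡⇒%-≡ x {p} {q} eq =
    iter-≡⇒≡ x (m%n<n p (period x)) (m%n<n q (period x)) (trans (sym (iter-% x p)) (trans eq (iter-% x q)))

  -- The representative of an orbit is its element of least index.
  stepsToRep : X → ℕ
  stepsToRep x = argmin (λ k → idx (iter k σ x)) (pred (period x))

  rep : X → X
  rep x = iter (stepsToRep x) σ x

  rep-minimal : ∀ x k → idx (rep x) ≤ idx (iter k σ x)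
  rep-minimal x k = subst (λ y → idx (rep x) ≤ idx y) (sym (iter-% x k))
    (argmin-minimal (λ k → idx (iter k σ x)) (≤-pred (subst (k % period x <_) (sym (suc-pred (period x))) (m%n<n k (period x)))))

  rep-σ : ∀ x → rep (σ x) ≡ rep x
  rep-σ x = idx-injective (≤-antisym
    (subst (λ y → idx (rep (σ x)) ≤ idx y) around (rep-minimal (σ x) (pred (period x) + stepsToRep x)))
    (rep-minimal x (suc (stepsToRep (σ x)))))
    where
    around : iter (pred (period x) + stepsToRep x) σ (σ x) ≡ rep x
    around = trans (cong (λ i → iter (i + stepsToRep x) σ x) (suc-pred (period x)))
               (trans (iter-+ σ (period x) (stepsToRep x) x) (cong (iter (stepsToRep x) σ) (iter-period x)))

  rep-iter : ∀ k x → rep (iter k σ x) ≡ rep x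
  rep-iter zero x = refl
  rep-iter (suc k) x = trans (rep-iter k (σ x)) (rep-σ x)

  IsRep : X → Set
  IsRep x = rep x ≡ x

  isRep? : Decidable IsRep
  isRep? x = rep x ≟X x

  rep-isRep : ∀ x → IsRep (rep x)
  rep-isRep x = rep-iter (stepsToRep x) x

  -- Going on for (period − 1) · stepsToRep steps from rep x completes period · stepsToRep steps from x.
  stepsFromRep : X → ℕ
  stepsFromRep x = stepsToRep x * pred (period x)

  iter-stepsFromRep : ∀ x → iter (stepsFromRep x) σ (rep x) ≡ x
  iter-stepsFromRep x = begin
    iter (stepsFromRep x) σ (rep x)        ≡⟨ iter-+ σ (stepsToRep x) (stepsFromRep x) x ⟨
    iter (stepsToRep x + stepsFromRep x) σ x ≡⟨ cong (λ i → iter i σ x) total ⟩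
    iter (stepsToRep x * period x) σ x     ≡⟨ iter-*-periodic σ (period x) (iter-period x) (stepsToRep x) ⟩
    x                                      ∎
    where
    open ≡-Reasoning
    total : stepsToRep x + stepsFromRep x ≡ stepsToRep x * period x
    total = trans (sym (*-suc (stepsToRep x) (pred (period x)))) (cong (stepsToRep x *_) (suc-pred (period x)))

  stepsFromRep-isRep : ∀ x → IsRep x → stepsFromRep x % period x ≡ 0
  stepsFromRep-isRep x x-rep = trans (iter-≡⇒%-≡ x (trans (cong (iter (stepsFromRep x) σ) (sym x-rep)) (iter-stepsFromRep x)))
    (m<n⇒m%n≡m (>-nonZero⁻¹ (period x)))

  module _ (B : X → Bool) (B-σ : ∀ x → B (σ x) ≡ B x) where

    B-iter : ∀ k x → B (iter k σ x) ≡ B x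
    B-iter zero x = refl
    B-iter (suc k) x = trans (B-iter k (σ x)) (B-σ x)

    module _ (ℓ : ℕ) .{{_ : NonZero ℓ}} (period≡ℓ : ∀ x → T (B x) → period x ≡ ℓ) where

      private
        RepInB : X → Set
        RepInB x = IsRep x × T (B x)

        repInB? : Decidable RepInB
        repInB? x = isRep? x ×-dec T? (B x)

        toCoordinates : X → X × Fin ℓ
        toCoordinates x = rep x , fromℕ< (m%n<n (stepsFromRep x) ℓ)

        fromCoordinates : X × Fin ℓ → X
        fromCoordinates (y , k) = iter (toℕ k) σ y

        B-rep : ∀ x → T (B x) → T (B (rep x))
        B-rep x Bx = subst T (sym (B-iter (stepsToRep x) x)) Bx

        from∘to : ∀ x → T (B x) → fromCoordinates (toCoordinates x) ≡ x
        from∘to x Bx = begin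
          iter (toℕ (fromℕ< (m%n<n (stepsFromRep x) ℓ))) σ (rep x)
            ≡⟨ cong (λ i → iter i σ (rep x)) (FinP.toℕ-fromℕ< (m%n<n (stepsFromRep x) ℓ)) ⟩
          iter (stepsFromRep x % ℓ) σ (rep x)
            ≡⟨ cong (λ i → iter i σ (rep x)) (%-congʳ (sym (period≡ℓ (rep x) (B-rep x Bx)))) ⟩
          iter (stepsFromRep x % period (rep x)) σ (rep x)
            ≡⟨ iter-% (rep x) (stepsFromRep x) ⟨
          iter (stepsFromRep x) σ (rep x)
            ≡⟨ iter-stepsFromRep x ⟩
          x ∎
          where open ≡-Reasoning

        to∘from : ∀ y k → RepInB y → toCoordinates (fromCoordinates (y , k)) ≡ (y , k)
        to∘from y k (y-rep , By) = ProductP.×-≡,≡→≡ (rep-z≡y , FinP.toℕ-injective (begin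
          toℕ (fromℕ< (m%n<n (stepsFromRep z) ℓ)) ≡⟨ FinP.toℕ-fromℕ< _ ⟩
          stepsFromRep z % ℓ                      ≡⟨ %-congʳ (sym (period≡ℓ y By)) ⟩
          stepsFromRep z % period y               ≡⟨ iter-≡⇒%-≡ y same-point ⟩
          toℕ k % period y                        ≡⟨ %-congʳ (period≡ℓ y By) ⟩
          toℕ k % ℓ                               ≡⟨ m<n⇒m%n≡m (FinP.toℕ<n k) ⟩
          toℕ k                                   ∎))
          where
          open ≡-Reasoning
          z = iter (toℕ k) σ y
          rep-z≡y : rep z ≡ y
          rep-z≡y = trans (rep-iter (toℕ k) y) y-rep
          same-point : iter (stepsFromRep z) σ y ≡ iter (toℕ k) σ y
          same-point = trans (cong (iter (stepsFromRep z) σ) (sym rep-z≡y)) (iter-stepsFromRep z)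

      -- x ↦ (rep x , stepsFromRep x mod ℓ) is a bijection from the B-class onto its representatives × Fin ℓ.
      count-reps : (xs : List X) → (∀ x → count (_≟X x) xs ≡ 1) → ℓ * count repInB? xs ≡ count (T? ∘ B) xs
      count-reps xs xs-enumerates = sym (begin
        count (T? ∘ B) xs
          ≡⟨ CountBijection.count-≡ (decSetoid _≟X_) (decSetoid _≟P_) (T? ∘ B) pair?
               (λ { refl Bx → Bx }) (λ { refl q → q }) xs pairs (λ x _ → xs-enumerates x) (λ (y , k) _ → pairs-enumerate y k)
               toCoordinates fromCoordinates (cong toCoordinates) (cong fromCoordinates)
               (λ x Bx → (rep-isRep x , B-rep x Bx) , tt) (λ (y , k) ((_ , By) , _) → subst T (sym (B-iter (toℕ k) y)) By)
               from∘to (λ (y , k) (y-repInB , _) → to∘from y k y-repInB) ⟩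
        count pair? pairs
          ≡⟨ count-cartesianProduct-× repInB? (λ _ → yes tt) xs (allFin ℓ) ⟩
        count repInB? xs * count (λ _ → yes tt) (allFin ℓ)
          ≡⟨ cong (count repInB? xs *_) (trans (count-all _ (allFin ℓ) (λ _ → tt)) (length-allFin ℓ)) ⟩
        count repInB? xs * ℓ
          ≡⟨ *-comm _ ℓ ⟩
        ℓ * count repInB? xs ∎)
        where
        open ≡-Reasoning
        _≟P_ : (p q : X × Fin ℓ) → Dec (p ≡ q)
        _≟P_ = ProductP.≡-dec _≟X_ FinP._≟_
        pairs : List (X × Fin ℓ)
        pairs = cartesianProduct xs (allFin ℓ)
        pair? : Decidable (λ (p : X × Fin ℓ) → RepInB (proj₁ p) × ⊤)
        pair? (y , _) = repInB? y ×-dec yes tt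
        pairs-enumerate : ∀ y k → count (_≟P (y , k)) pairs ≡ 1
        pairs-enumerate y k = trans (count-cartesianProduct-≡ _≟X_ FinP._≟_ xs (allFin ℓ))
          (cong₂ _*_ (xs-enumerates y) (count-allFin-≡ k))

-- Equivariant tilings of the torus

allCells : ∀ n → List (Cell n)
allCells n = cartesianProduct (allFin n) (allFin n)

_≟C_ : ∀ {n} (c d : Cell n) → Dec (c ≡ d)
_≟C_ = ProductP.≡-dec FinP._≟_ FinP._≟_

count-allCells-≡ : ∀ {n} (c : Cell n) → count (_≟C c) (allCells n) ≡ 1
count-allCells-≡ {n} (x , y) =
  trans (count-cartesianProduct-≡ FinP._≟_ FinP._≟_ (allFin n) (allFin n)) (cong₂ _*_ (count-allFin-≡ x) (count-allFin-≡ y))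

length-allCells : ∀ n → length (allCells n) ≡ n * n
length-allCells n = trans (length-cartesianProduct (allFin n) (allFin n)) (cong₂ _*_ (length-allFin n) (length-allFin n))

count-allCells-proj₁ : ∀ n (B : Fin n → Bool) → count (T? ∘ B ∘ proj₁) (allCells n) ≡ count (T? ∘ B) (allFin n) * n
count-allCells-proj₁ n B = begin
  count (T? ∘ B ∘ proj₁) (allCells n)
    ≡⟨ count-cong _ _ ((_, tt) , proj₁) (allCells n) ⟩
  count (λ (x , y) → T? (B x) ×-dec yes tt) (allCells n)
    ≡⟨ count-cartesianProduct-× (T? ∘ B) (λ _ → yes tt) (allFin n) (allFin n) ⟩
  count (T? ∘ B) (allFin n) * count (λ _ → yes tt) (allFin n)
    ≡⟨ cong (count (T? ∘ B) (allFin n) *_) (trans (count-all _ (allFin n) (λ _ → tt)) (length-allFin n)) ⟩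
  count (T? ∘ B) (allFin n) * n ∎
  where open ≡-Reasoning

count-allCells-proj₂ : ∀ n (B : Fin n → Bool) → count (T? ∘ B ∘ proj₂) (allCells n) ≡ n * count (T? ∘ B) (allFin n)
count-allCells-proj₂ n B = begin
  count (T? ∘ B ∘ proj₂) (allCells n)
    ≡⟨ count-cong _ _ ((tt ,_) , proj₂) (allCells n) ⟩
  count (λ (x , y) → yes tt ×-dec T? (B y)) (allCells n)
    ≡⟨ count-cartesianProduct-× (λ _ → yes tt) (T? ∘ B) (allFin n) (allFin n) ⟩
  count (λ _ → yes tt) (allFin n) * count (T? ∘ B) (allFin n)
    ≡⟨ cong (_* count (T? ∘ B) (allFin n)) (trans (count-all _ (allFin n) (λ _ → tt)) (length-allFin n)) ⟩
  n * count (T? ∘ B) (allFin n) ∎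
  where open ≡-Reasoning

count-allCells-∧ : ∀ n (B₁ B₂ : Fin n → Bool) →
  count (λ (x , y) → T? (B₁ x ∧ B₂ y)) (allCells n) ≡ count (T? ∘ B₁) (allFin n) * count (T? ∘ B₂) (allFin n)
count-allCells-∧ n B₁ B₂ = trans
  (count-cong _ (λ (x , y) → T? (B₁ x) ×-dec T? (B₂ y))
    ((λ {(x , y)} → Equivalence.to BoolP.T-∧) , (λ {(x , y)} → Equivalence.from BoolP.T-∧)) (allCells n))
  (count-cartesianProduct-× (T? ∘ B₁) (T? ∘ B₂) (allFin n) (allFin n))

count-not : ∀ n (B : Cell n → Bool) → count (T? ∘ not ∘ B) (allCells n) ≡ n * n ∸ count (T? ∘ B) (allCells n)
count-not n B = begin
  count (T? ∘ not ∘ B) (allCells n)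
    ≡⟨ count-cong (T? ∘ not ∘ B) (¬? ∘ T? ∘ B)
         ((λ {c} → Equivalence.to (T-not⇔¬T (B c))) , (λ {c} → Equivalence.from (T-not⇔¬T (B c)))) (allCells n) ⟩
  count (¬? ∘ T? ∘ B) (allCells n)
    ≡⟨ m+n∸m≡n (count (T? ∘ B) (allCells n)) _ ⟨
  count (T? ∘ B) (allCells n) + count (¬? ∘ T? ∘ B) (allCells n) ∸ count (T? ∘ B) (allCells n)
    ≡⟨ cong (_∸ count (T? ∘ B) (allCells n)) (trans (count-+-count-¬ (T? ∘ B) (allCells n)) (length-allCells n)) ⟩
  n * n ∸ count (T? ∘ B) (allCells n) ∎
  where open ≡-Reasoning

cellIndex : ∀ {n} → Cell n → ℕ
cellIndex (x , y) = toℕ (combine x y)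

cellIndex-injective : ∀ {n} {c d : Cell n} → cellIndex c ≡ cellIndex d → c ≡ d
cellIndex-injective {c = x , y} {x′ , y′} eq =
  ProductP.×-≡,≡→≡ (FinP.combine-injective x y x′ y′ (FinP.toℕ-injective eq))

allCells? : ∀ {n} {P : Cell n → Set} → Decidable P → Dec (∀ c → P c)
allCells? P? = map′ (λ h c → h (proj₁ c) (proj₂ c)) (λ h x y → h (x , y)) (FinP.all? λ x → FinP.all? λ y → P? (x , y))

count-allTilings : ∀ n m {P : Cell n → Fin m → Set} (P? : ∀ c → Decidable (P c))
  {Q : Tiling n m → Set} (Q? : Decidable Q) → (∀ τ → Q τ ⇔ (∀ c → P c (τ c))) →
  count Q? (allTilings n m) ≡ product (map (λ c → count (P? c) (allFin m)) (allCells n))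
count-allTilings n m {P} P? Q? Q⇔ = begin
  count Q? (map uncurry (allFunctions n (allFunctions n (allFin m))))
    ≡⟨ count-map Q? uncurry (allFunctions n (allFunctions n (allFin m))) ⟩
  count (Q? ∘ uncurry) (allFunctions n (allFunctions n (allFin m)))
    ≡⟨ count-allFunctions n (allFunctions n (allFin m)) column? (Q? ∘ uncurry) (λ τ → mk⇔
         (λ q x y → Equivalence.to (Q⇔ (uncurry τ)) q (x , y))
         (λ p → Equivalence.from (Q⇔ (uncurry τ)) (λ (x , y) → p x y))) ⟩
  product (map (λ x → count (column? x) (allFunctions n (allFin m))) (allFin n))
    ≡⟨ product-map-cong (λ x → count-allFunctions n (allFin m) (λ y → P? (x , y)) (column? x) (λ _ → mk⇔ id id))
                        (allFin n) ⟩
  product (map (λ x → product (map (λ y → count (P? (x , y)) (allFin m)) (allFin n))) (allFin n))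
    ≡⟨ product-cartesianProduct (λ c → count (P? c) (allFin m)) (allFin n) (allFin n) ⟨
  product (map (λ c → count (P? c) (allFin m)) (allCells n)) ∎
  where
  open ≡-Reasoning
  column? : ∀ x → Decidable (λ (g : Fin n → Fin m) → ∀ y → P (x , y) (g y))
  column? x g = FinP.all? (λ y → P? (x , y) (g y))

tilingSetoid : ℕ → ℕ → DecSetoid 0ℓ 0ℓ
tilingSetoid n m = record
  { Carrier = Tiling n m
  ; _≈_ = λ τ τ′ → ∀ c → τ c ≡ τ′ c
  ; isDecEquivalence = record
    { isEquivalence = record
      { refl = λ c → refl ; sym = λ eq c → sym (eq c) ; trans = λ eq eq′ c → trans (eq c) (eq′ c) }
    ; _≟_ = λ τ τ′ → allCells? (λ c → τ c FinP.≟ τ′ c) } }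

count-allTilings-≈ : ∀ n m (τ : Tiling n m) → count (λ τ′ → DecSetoid._≟_ (tilingSetoid n m) τ′ τ) (allTilings n m) ≡ 1
count-allTilings-≈ n m τ = begin
  count _ (allTilings n m)
    ≡⟨ count-allTilings n m (λ c v → v FinP.≟ τ c) _ (λ _ → mk⇔ (λ eq → eq) (λ eq → eq)) ⟩
  product (map (λ c → count (FinP._≟ τ c) (allFin m)) (allCells n))
    ≡⟨ product-map-cong (λ c → count-allFin-≡ (τ c)) (allCells n) ⟩
  product (map (λ _ → 1) (allCells n))
    ≡⟨ product-map-one (allCells n) ⟩
  1 ∎
  where open ≡-Reasoning

div-exact : ∀ ℓ .{{_ : NonZero ℓ}} {q M} → ℓ * q ≡ M → M div ℓ ≡ q
div-exact (suc ℓ) {q} refl = trans (cong (_/ suc ℓ) (*-comm (suc ℓ) q)) (m*n/n≡m q (suc ℓ))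

module EquivariantTilings (n : ℕ) .{{_ : NonZero n}} (σ : Cell n → Cell n)
  (period : Cell n → ℕ) (period-nonZero : ∀ c → NonZero (period c))
  (iter-≡⇔period-∣ : ∀ c k → iter k σ c ≡ c ⇔ period c ∣ k) where

  open Orbits cellIndex cellIndex-injective σ period period-nonZero iter-≡⇔period-∣

  private instance
    period-nonZero′ : ∀ {c} → NonZero (period c)
    period-nonZero′ {c} = period-nonZero c

  module _ {m : ℕ} (α : Fin m → Fin m) where

    Equivariant : Tiling n m → Set
    Equivariant τ = ∀ c → τ (σ c) ≡ α (τ c)

    fixedTiles : ℕ → ℕ
    fixedTiles ℓ = count (λ v → iter ℓ α v FinP.≟ v) (allFin m)

    orbitWeight : Cell n → ℕ
    orbitWeight c = if does (isRep? c) then fixedTiles (period c) else 1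

    iter-equivariant : ∀ {τ} → Equivariant τ → ∀ k c → τ (iter k σ c) ≡ iter k α (τ c)
    iter-equivariant τ-eq zero c = refl
    iter-equivariant {τ} τ-eq (suc k) c = trans (iter-equivariant τ-eq k (σ c)) (cong (iter k α) (τ-eq c))

  -- An equivariant tiling is determined by its values on representatives, which
  -- must be fixed by α^period; the values elsewhere are normalised to tile zero.
  private module NonEmpty (m : ℕ) (α : Fin (suc m) → Fin (suc m)) where

    RepDatum : Cell n → Fin (suc m) → Set
    RepDatum c v = (IsRep c → iter (period c) α v ≡ v) × (¬ IsRep c → v ≡ zero)

    repDatum? : ∀ c → Decidable (RepDatum c)
    repDatum? c v = (isRep? c →-dec (iter (period c) α v FinP.≟ v)) ×-dec (¬? (isRep? c) →-dec (v FinP.≟ zero))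

    RepData : Tiling n (suc m) → Set
    RepData h = ∀ c → RepDatum c (h c)

    repData? : Decidable RepData
    repData? h = allCells? (λ c → repDatum? c (h c))

    count-repDatum : ∀ c → count (repDatum? c) (allFin (suc m)) ≡ orbitWeight α c
    count-repDatum c = case isRep? c of λ where
      (yes c-rep) → trans
        (count-cong (repDatum? c) (λ v → iter (period c) α v FinP.≟ v)
          ((λ d → proj₁ d c-rep) , (λ fix → (λ _ → fix) , (λ ¬rep → ⊥-elim (¬rep c-rep)))) (allFin (suc m)))
        (sym (if-dec-yes (isRep? c) c-rep))
      (no ¬rep) → trans
        (count-cong (repDatum? c) (FinP._≟ zero)
          ((λ d → proj₂ d ¬rep) , (λ v≡0 → (λ rep → ⊥-elim (¬rep rep)) , (λ _ → v≡0))) (allFin (suc m)))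
        (trans (count-allFin-≡ {suc m} zero) (sym (if-dec-no (isRep? c) ¬rep)))

    restrict : Tiling n (suc m) → Tiling n (suc m)
    restrict τ c = if does (isRep? c) then τ c else zero

    extend : Tiling n (suc m) → Tiling n (suc m)
    extend h c = iter (stepsFromRep c) α (h (rep c))

    restrict-rep : ∀ τ {c} → IsRep c → restrict τ c ≡ τ c
    restrict-rep τ {c} = if-dec-yes (isRep? c)

    restrict-¬rep : ∀ τ {c} → ¬ IsRep c → restrict τ c ≡ zero
    restrict-¬rep τ {c} = if-dec-no (isRep? c)

    restrict-repData : ∀ τ → Equivariant α τ → RepData (restrict τ)
    restrict-repData τ τ-eq c =
      (λ c-rep → begin
         iter (period c) α (restrict τ c) ≡⟨ cong (iter (period c) α) (restrict-rep τ c-rep) ⟩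
         iter (period c) α (τ c)          ≡⟨ iter-equivariant α τ-eq (period c) c ⟨
         τ (iter (period c) σ c)          ≡⟨ cong τ (iter-period c) ⟩
         τ c                              ≡⟨ restrict-rep τ c-rep ⟨
         restrict τ c                     ∎)
      , restrict-¬rep τ
      where open ≡-Reasoning

    extend-equivariant : ∀ h → RepData h → Equivariant α (extend h)
    extend-equivariant h h-data c = begin
      iter (stepsFromRep (σ c)) α (h (rep (σ c))) ≡⟨ cong (λ z → iter (stepsFromRep (σ c)) α (h z)) (rep-σ c) ⟩
      iter (stepsFromRep (σ c)) α v               ≡⟨ iter-%-periodic α (period y) v-fix (stepsFromRep (σ c)) ⟩
      iter (stepsFromRep (σ c) % period y) α v
        ≡⟨ cong (λ i → iter i α v) same-step ⟩
      iter (suc (stepsFromRep c) % period y) α v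
        ≡⟨ iter-%-periodic α (period y) v-fix (suc (stepsFromRep c)) ⟨
      iter (suc (stepsFromRep c)) α v             ≡⟨ iter-suc α (stepsFromRep c) v ⟩
      α (iter (stepsFromRep c) α v)               ∎
      where
      open ≡-Reasoning
      y = rep c
      v = h y
      v-fix : iter (period y) α v ≡ v
      v-fix = proj₁ (h-data y) (rep-isRep c)
      same-step : stepsFromRep (σ c) % period y ≡ suc (stepsFromRep c) % period y
      same-step = iter-≡⇒%-≡ y (begin
        iter (stepsFromRep (σ c)) σ y       ≡⟨ cong (iter (stepsFromRep (σ c)) σ) (rep-σ c) ⟨
        iter (stepsFromRep (σ c)) σ (rep (σ c)) ≡⟨ iter-stepsFromRep (σ c) ⟩
        σ c                                 ≡⟨ cong σ (iter-stepsFromRep c) ⟨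
        σ (iter (stepsFromRep c) σ y)       ≡⟨ iter-suc σ (stepsFromRep c) y ⟨
        iter (suc (stepsFromRep c)) σ y     ∎)

    extend-restrict : ∀ τ → Equivariant α τ → ∀ c → extend (restrict τ) c ≡ τ c
    extend-restrict τ τ-eq c = begin
      iter (stepsFromRep c) α (restrict τ (rep c)) ≡⟨ cong (iter (stepsFromRep c) α) (restrict-rep τ (rep-isRep c)) ⟩
      iter (stepsFromRep c) α (τ (rep c))          ≡⟨ iter-equivariant α τ-eq (stepsFromRep c) (rep c) ⟨
      τ (iter (stepsFromRep c) σ (rep c))          ≡⟨ cong τ (iter-stepsFromRep c) ⟩
      τ c                                          ∎
      where open ≡-Reasoning

    restrict-extend : ∀ h → RepData h → ∀ c → restrict (extend h) c ≡ h c
    restrict-extend h h-data c with isRep? c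
    ... | no ¬rep = trans (restrict-¬rep (extend h) ¬rep) (sym (proj₂ (h-data c) ¬rep))
    ... | yes c-rep = begin
      restrict (extend h) c               ≡⟨ restrict-rep (extend h) c-rep ⟩
      iter (stepsFromRep c) α (h (rep c)) ≡⟨ cong (λ z → iter (stepsFromRep c) α (h z)) c-rep ⟩
      iter (stepsFromRep c) α (h c)       ≡⟨ iter-%-periodic α (period c) (proj₁ (h-data c) c-rep) (stepsFromRep c) ⟩
      iter (stepsFromRep c % period c) α (h c) ≡⟨ cong (λ i → iter i α (h c)) (stepsFromRep-isRep c c-rep) ⟩
      h c                                 ∎
      where open ≡-Reasoning

    count-equivariant : (eq? : Decidable (Equivariant α)) →
      count eq? (allTilings n (suc m)) ≡ product (map (orbitWeight α) (allCells n))
    count-equivariant eq? = begin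
      count eq? (allTilings n (suc m))
        ≡⟨ CountBijection.count-≡ (tilingSetoid n (suc m)) (tilingSetoid n (suc m)) eq? repData?
             (λ τ≈ τ-eq c → trans (τ≈ (σ c)) (trans (τ-eq c) (cong α (sym (τ≈ c)))))
             (λ h≈ h-data c → subst (RepDatum c) (sym (h≈ c)) (h-data c))
             (allTilings n (suc m)) (allTilings n (suc m))
             (λ τ _ → count-allTilings-≈ n (suc m) τ) (λ h _ → count-allTilings-≈ n (suc m) h)
             restrict extend restrict-cong (λ h≈ c → cong (iter (stepsFromRep c) α) (h≈ (rep c)))
             restrict-repData extend-equivariant extend-restrict restrict-extend ⟩
      count repData? (allTilings n (suc m))
        ≡⟨ count-allTilings n (suc m) repDatum? repData? (λ _ → mk⇔ id id) ⟩
      product (map (λ c → count (repDatum? c) (allFin (suc m))) (allCells n))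
        ≡⟨ product-map-cong count-repDatum (allCells n) ⟩
      product (map (orbitWeight α) (allCells n)) ∎
      where
      open ≡-Reasoning
      restrict-cong : ∀ {τ τ′} → (∀ c → τ′ c ≡ τ c) → ∀ c → restrict τ′ c ≡ restrict τ c
      restrict-cong {τ} {τ′} τ≈ c with isRep? c
      ... | yes c-rep = trans (restrict-rep τ′ c-rep) (trans (τ≈ c) (sym (restrict-rep τ c-rep)))
      ... | no ¬rep = trans (restrict-¬rep τ′ ¬rep) (sym (restrict-¬rep τ ¬rep))

  count-equivariant : ∀ {m} (α : Fin m → Fin m) (eq? : Decidable (Equivariant α)) →
    count eq? (allTilings n m) ≡ product (map (orbitWeight α) (allCells n))
  count-equivariant {suc m} α eq? = NonEmpty.count-equivariant m α eq?
  count-equivariant {zero} α eq? =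
    trans (cong (count eq?) no-tilings) (sym (product-map-zero (orbitWeight α) (∈-allCells (rep c₀)) weight≡0))
    where
    no-functions : ∀ {A : Set} k .{{_ : NonZero k}} → allFunctions {A} k [] ≡ []
    no-functions (suc k) = refl
    no-tilings : allTilings n 0 ≡ []
    no-tilings = cong (map uncurry) (trans (cong (allFunctions n) (no-functions n)) (no-functions n))
    c₀ : Cell n
    c₀ = fromℕ< (>-nonZero⁻¹ n) , fromℕ< (>-nonZero⁻¹ n)
    ∈-allCells : ∀ c → c ∈ allCells n
    ∈-allCells (x , y) = ∈-cartesianProduct⁺ (∈-allFin x) (∈-allFin y)
    weight≡0 : orbitWeight α (rep c₀) ≡ 0
    weight≡0 = if-dec-yes (isRep? (rep c₀)) (rep-isRep c₀)

  count-equivariant-two-classes : ∀ {m} (α : Fin m → Fin m) (B : Cell n → Bool) → (∀ c → B (σ c) ≡ B c) →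
    (ℓ₁ ℓ₂ : ℕ) .{{_ : NonZero ℓ₁}} .{{_ : NonZero ℓ₂}} → (∀ c → period c ≡ (if B c then ℓ₁ else ℓ₂)) →
    (eq? : Decidable (Equivariant α)) →
    count eq? (allTilings n m) ≡ fixedTiles α ℓ₁ ^ (count (T? ∘ B) (allCells n) div ℓ₁)
                                 * fixedTiles α ℓ₂ ^ ((n * n ∸ count (T? ∘ B) (allCells n)) div ℓ₂)
  count-equivariant-two-classes α B B-σ ℓ₁ ℓ₂ period≡ eq? = begin
    count eq? (allTilings n _)
      ≡⟨ count-equivariant α eq? ⟩
    product (map (orbitWeight α) (allCells n))
      ≡⟨ product-map-cong weight-split (allCells n) ⟩
    product (map (λ c → weight₁ c * weight₂ c) (allCells n))
      ≡⟨ product-map-* weight₁ weight₂ (allCells n) ⟩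
    product (map weight₁ (allCells n)) * product (map weight₂ (allCells n))
      ≡⟨ cong₂ _*_ (product-map-indicator rep₁? N₁ (allCells n)) (product-map-indicator rep₂? N₂ (allCells n)) ⟩
    N₁ ^ count rep₁? (allCells n) * N₂ ^ count rep₂? (allCells n)
      ≡⟨ cong₂ (λ k₁ k₂ → N₁ ^ k₁ * N₂ ^ k₂) (sym (div-exact ℓ₁ reps₁))
                                             (sym (div-exact ℓ₂ (trans reps₂ (count-not n B)))) ⟩
    N₁ ^ (count (T? ∘ B) (allCells n) div ℓ₁) * N₂ ^ ((n * n ∸ count (T? ∘ B) (allCells n)) div ℓ₂) ∎
    where
    open ≡-Reasoning
    N₁ = fixedTiles α ℓ₁
    N₂ = fixedTiles α ℓ₂
    enumerates : ∀ c → count (_≟X c) (allCells n) ≡ 1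
    enumerates c = trans (count-cong (_≟X c) (_≟C c) (id , id) (allCells n)) (count-allCells-≡ c)
    rep₁? : Decidable (λ c → IsRep c × T (B c))
    rep₂? : Decidable (λ c → IsRep c × T (not (B c)))
    rep₁? c = isRep? c ×-dec T? (B c)
    rep₂? c = isRep? c ×-dec T? (not (B c))
    weight₁ weight₂ : Cell n → ℕ
    weight₁ c = if does (rep₁? c) then N₁ else 1
    weight₂ c = if does (rep₂? c) then N₂ else 1
    split : ∀ r b → (if r then fixedTiles α (if b then ℓ₁ else ℓ₂) else 1)
                    ≡ (if r ∧ b then N₁ else 1) * (if r ∧ not b then N₂ else 1)
    split true true = sym (*-identityʳ N₁)
    split true false = sym (*-identityˡ N₂)
    split false _ = refl
    weight-split : ∀ c → orbitWeight α c ≡ weight₁ c * weight₂ c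
    weight-split c = trans (cong (λ p → if does (isRep? c) then fixedTiles α p else 1) (period≡ c))
                           (split (does (isRep? c)) (B c))
    reps₁ : ℓ₁ * count rep₁? (allCells n) ≡ count (T? ∘ B) (allCells n)
    reps₁ = count-reps B B-σ ℓ₁ (λ c Bc → trans (period≡ c) (if-dec-yes (T? (B c)) Bc)) (allCells n) enumerates
    reps₂ : ℓ₂ * count rep₂? (allCells n) ≡ count (T? ∘ not ∘ B) (allCells n)
    reps₂ = count-reps (not ∘ B) (λ c → cong not (B-σ c)) ℓ₂
              (λ c ¬Bc → trans (period≡ c) (if-dec-no (T? (B c)) (Equivalence.to (T-not⇔¬T (B c)) ¬Bc))) (allCells n) enumerates

-- Translations and reflections of ℤ/n

half-monoˡ-≤ : ∀ p q → p + p ≤ q + q → p ≤ q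
half-monoˡ-≤ p q le = ≮⇒≥ (λ lt → <⇒≱ (+-mono-< lt lt) le)

half-mono-< : ∀ p q → p + p < q + q → p < q
half-mono-< p q lt = ≰⇒> (λ le → <⇒≱ lt (+-mono-≤ le le))

double-injective : ∀ {p q} → p + p ≡ q + q → p ≡ q
double-injective {p} {q} eq with <-cmp p q
... | tri< p<q _ _ = ⊥-elim (<-irrefl eq (+-mono-< p<q p<q))
... | tri≈ _ p≡q _ = p≡q
... | tri> _ _ q<p = ⊥-elim (<-irrefl (sym eq) (+-mono-< q<p q<p))

∸-suc-< : ∀ m .{{_ : NonZero m}} k → m ∸ suc k < m
∸-suc-< (suc m) k = s≤s (m∸n≤m m k)

∸-suc-involutive : ∀ {m k} → k < m → m ∸ suc (m ∸ suc k) ≡ k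
∸-suc-involutive {suc m} (s≤s k≤m) = m∸[m∸n]≡n k≤m

module ℤmod (n : ℕ) .{{n≢0 : NonZero n}} where

  translate : Fin n → Fin n → Fin n
  translate a x = (toℕ x + toℕ a) mod n

  toℕ-translate : ∀ a x → toℕ (translate a x) ≡ (toℕ x + toℕ a) % n
  toℕ-translate a x = FinP.toℕ-fromℕ< _

  iter-translate : ∀ a k x → toℕ (iter k (translate a) x) ≡ (toℕ x + k * toℕ a) % n
  iter-translate a zero x = sym (trans (cong (_% n) (+-identityʳ _)) (m<n⇒m%n≡m (FinP.toℕ<n x)))
  iter-translate a (suc k) x = begin
    toℕ (iter k (translate a) (translate a x)) ≡⟨ iter-translate a k (translate a x) ⟩
    (toℕ (translate a x) + k * A) % n          ≡⟨ cong (λ z → (z + k * A) % n) (toℕ-translate a x) ⟩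
    ((X + A) % n + k * A) % n                  ≡⟨ %-distribˡ-+ ((X + A) % n) (k * A) n ⟩
    ((X + A) % n % n + k * A % n) % n          ≡⟨ cong (λ z → (z + k * A % n) % n) (m%n%n≡m%n (X + A) n) ⟩
    ((X + A) % n + k * A % n) % n              ≡⟨ %-distribˡ-+ (X + A) (k * A) n ⟨
    (X + A + k * A) % n                        ≡⟨ cong (_% n) (+-assoc X A (k * A)) ⟩
    (X + suc k * A) % n                        ∎
    where
    open ≡-Reasoning
    X = toℕ x
    A = toℕ a

  gcd[-,n]-nonZero : ∀ k → NonZero (gcd k n)
  gcd[-,n]-nonZero k = ≢-nonZero (gcd[m,n]≢0 k n (inj₂ (≢-nonZero⁻¹ n)))

  order : ℕ → ℕ
  order k = (n / gcd k n) {{gcd[-,n]-nonZero k}}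

  order-∣-n : ∀ k → order k ∣ n
  order-∣-n k = divides (gcd k n) (sym (m*[n/m]≡n (gcd[m,n]∣n k n)))
    where instance _ = gcd[-,n]-nonZero k

  order-positive : ∀ k → 0 < order k
  order-positive k = m≥n⇒m/n>0 (gcd[m,n]≤n k n)
    where instance _ = gcd[-,n]-nonZero k

  n∣*⇔order∣ : ∀ k t → n ∣ t * k ⇔ order k ∣ t
  n∣*⇔order∣ k t = mk⇔ to from
    where
    instance _ = gcd[-,n]-nonZero k
    g = gcd k n
    n≡g*order : g * order k ≡ n
    n≡g*order = m*[n/m]≡n (gcd[m,n]∣n k n)
    k≡g*k′ : g * (k / g) ≡ k
    k≡g*k′ = m*[n/m]≡n (gcd[m,n]∣m k n)
    t*k≡ : t * k ≡ g * (t * (k / g))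
    t*k≡ = trans (cong (t *_) (sym k≡g*k′)) (swap t g (k / g))
      where
      swap : ∀ a b c → a * (b * c) ≡ b * (a * c)
      swap = solve-∀
    to : n ∣ t * k → order k ∣ t
    to n∣tk = coprime-divisor (Coprimality.sym (coprime-/gcd k n))
      (subst (order k ∣_) (*-comm t (k / g)) (*-cancelˡ-∣ g (subst₂ _∣_ (sym n≡g*order) t*k≡ n∣tk)))
    from : order k ∣ t → n ∣ t * k
    from order∣t = subst₂ _∣_ n≡g*order (sym t*k≡) (*-monoʳ-∣ g (∣-trans order∣t (m∣m*n (k / g))))

  iter-translate-≡⇔order-∣ : ∀ a x k → iter k (translate a) x ≡ x ⇔ order (toℕ a) ∣ k
  iter-translate-≡⇔order-∣ a x k = mk⇔ to from
    where
    X = toℕ x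
    A = toℕ a
    to : iter k (translate a) x ≡ x → order A ∣ k
    to fix = Equivalence.to (n∣*⇔order∣ A k) (divides ((X + k * A) / n) (+-cancelˡ-≡ X _ _ (begin
      X + k * A                    ≡⟨ m≡m%n+[m/n]*n (X + k * A) n ⟩
      (X + k * A) % n + (X + k * A) / n * n ≡⟨ cong (_+ (X + k * A) / n * n) (trans (sym (iter-translate a k x)) (cong toℕ fix)) ⟩
      X + (X + k * A) / n * n      ∎)))
      where open ≡-Reasoning
    from : order A ∣ k → iter k (translate a) x ≡ x
    from order∣k = FinP.toℕ-injective (trans (iter-translate a k x)
      (trans (%-remove-+ʳ X (Equivalence.from (n∣*⇔order∣ A k) order∣k)) (m<n⇒m%n≡m (FinP.toℕ<n x))))

  -- opposite y = n − 1 − y, so reflect a is the reflection x ↦ n − 1 − (x + a).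
  reflect : Fin n → Fin n → Fin n
  reflect a x = opposite (translate a x)

  toℕ-reflect : ∀ a x → toℕ (reflect a x) ≡ n ∸ suc ((toℕ x + toℕ a) % n)
  toℕ-reflect a x = trans (FinP.opposite-prop (translate a x)) (cong (λ z → n ∸ suc z) (toℕ-translate a x))

  reflect-involutive : ∀ a x → reflect a (reflect a x) ≡ x
  reflect-involutive a x = FinP.toℕ-injective (begin
    toℕ (reflect a (reflect a x))          ≡⟨ toℕ-reflect a (reflect a x) ⟩
    n ∸ suc ((toℕ (reflect a x) + A) % n)  ≡⟨ cong (λ z → n ∸ suc ((z + A) % n)) (toℕ-reflect a x) ⟩
    n ∸ suc ((n ∸ suc R + A) % n)          ≡⟨ cong (λ z → n ∸ suc z) wrap ⟩
    n ∸ suc (n ∸ suc X)                    ≡⟨ ∸-suc-involutive (FinP.toℕ<n x) ⟩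
    X                                      ∎)
    where
    open ≡-Reasoning
    X = toℕ x
    A = toℕ a
    R = (X + A) % n
    q = (X + A) / n
    shift : ∀ s A X → s + A + suc X ≡ s + suc (X + A)
    shift = solve-∀
    regroup : ∀ s r Q → s + suc (r + Q) ≡ s + suc r + Q
    regroup = solve-∀
    move : ∀ s Q t → s + t + Q ≡ s + Q + t
    move = solve-∀
    key : n ∸ suc R + A ≡ n ∸ suc X + q * n
    key = +-cancelʳ-≡ (suc X) _ _ (begin
      n ∸ suc R + A + suc X        ≡⟨ shift (n ∸ suc R) A X ⟩
      n ∸ suc R + suc (X + A)      ≡⟨ cong (λ z → n ∸ suc R + suc z) (m≡m%n+[m/n]*n (X + A) n) ⟩
      n ∸ suc R + suc (R + q * n)  ≡⟨ regroup (n ∸ suc R) R (q * n) ⟩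
      n ∸ suc R + suc R + q * n    ≡⟨ cong (_+ q * n) (trans (m∸n+n≡m (m%n<n (X + A) n)) (sym (m∸n+n≡m (FinP.toℕ<n x)))) ⟩
      n ∸ suc X + suc X + q * n    ≡⟨ move (n ∸ suc X) (q * n) (suc X) ⟩
      n ∸ suc X + q * n + suc X    ∎)
    wrap : (n ∸ suc R + A) % n ≡ n ∸ suc X
    wrap = trans (cong (_% n) key) (trans ([m+kn]%n≡m%n (n ∸ suc X) q n) (m<n⇒m%n≡m (∸-suc-< n X)))

  -- x is fixed by reflect a iff n ∣ 2x + a + 1, and 0 < 2x + a + 1 < 3n.
  MirrorEquation : ℕ → ℕ → Set
  MirrorEquation A X = suc (X + X + A) ≡ n ⊎ suc (X + X + A) ≡ n + n

  private
    reflect-fixed⇔-complement : ∀ a x → reflect a x ≡ x ⇔ toℕ x + suc ((toℕ x + toℕ a) % n) ≡ n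
    reflect-fixed⇔-complement a x = mk⇔
      (λ fix → trans (cong (_+ suc R) (trans (sym (cong toℕ fix)) (toℕ-reflect a x))) (m∸n+n≡m (m%n<n (toℕ x + toℕ a) n)))
      (λ eq → FinP.toℕ-injective (trans (toℕ-reflect a x) (trans (cong (_∸ suc R) (sym eq)) (m+n∸n≡m (toℕ x) (suc R)))))
      where R = (toℕ x + toℕ a) % n

  reflect-fixed⇔ : ∀ a x → reflect a x ≡ x ⇔ MirrorEquation (toℕ a) (toℕ x)
  reflect-fixed⇔ a x = mk⇔ to from
    where
    X = toℕ x
    A = toℕ a
    R = (X + A) % n
    q = (X + A) / n
    q<2 : q < 2
    q<2 = m<n*o⇒m/o<n (subst (X + A <_) (cong (n +_) (sym (+-identityʳ n))) (+-mono-< (FinP.toℕ<n x) (FinP.toℕ<n a)))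
    lhs≡ : suc (X + X + A) ≡ X + suc R + q * n
    lhs≡ = trans (cong suc (+-assoc X X A)) (trans (cong (λ z → suc (X + z)) (m≡m%n+[m/n]*n (X + A) n)) (rearrange X R (q * n)))
      where
      rearrange : ∀ X R Q → suc (X + (R + Q)) ≡ X + suc R + Q
      rearrange = solve-∀
    fixed⇔ : reflect a x ≡ x ⇔ X + suc R ≡ n
    fixed⇔ = reflect-fixed⇔-complement a x
    X+suc-R<2n : X + suc R < n + n
    X+suc-R<2n = subst (_< n + n) (sym (+-suc X R)) (+-mono-≤-< (FinP.toℕ<n x) (m%n<n (X + A) n))
    to : reflect a x ≡ x → MirrorEquation A X
    to fix with q | q<2 | lhs≡
    ... | zero  | _ | eq = inj₁ (trans eq (trans (+-identityʳ _) (Equivalence.to fixed⇔ fix)))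
    ... | suc zero | _ | eq = inj₂ (trans eq (cong₂ _+_ (Equivalence.to fixed⇔ fix) (+-identityʳ n)))
    ... | suc (suc _) | s≤s (s≤s ()) | _
    from : MirrorEquation A X → reflect a x ≡ x
    from mirror with q | q<2 | lhs≡ | mirror
    ... | zero | _ | eq | inj₁ eq₁ = Equivalence.from fixed⇔ (trans (sym (trans eq (+-identityʳ _))) eq₁)
    ... | zero | _ | eq | inj₂ eq₂ = ⊥-elim (<-irrefl (trans (sym (trans eq (+-identityʳ _))) eq₂) X+suc-R<2n)
    ... | suc zero | _ | eq | inj₁ eq₁ =
      ⊥-elim (<-irrefl (trans (sym eq₁) (trans eq (cong (X + suc R +_) (+-identityʳ n))))
                       (m<n+m n (subst (0 <_) (sym (+-suc X R)) (s≤s z≤n))))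
    ... | suc zero | _ | eq | inj₂ eq₂ =
      Equivalence.from fixed⇔ (+-cancelʳ-≡ (n + 0) _ _ (trans (sym eq) (trans eq₂ (cong (n +_) (sym (+-identityʳ n))))))
    ... | suc (suc _) | s≤s (s≤s ()) | _ | _

  fixedPoints : Fin n → ℕ
  fixedPoints a = count (λ x → reflect a x FinP.≟ x) (allFin n)

  isFixed : Fin n → Fin n → Bool
  isFixed a x = does (reflect a x FinP.≟ x)

  isFixed-reflect : ∀ a x → isFixed a (reflect a x) ≡ isFixed a x
  isFixed-reflect a x = does-⇔ (involution-fixed-σ (reflect a) (reflect-involutive a) x)
    (reflect a (reflect a x) FinP.≟ reflect a x) (reflect a x FinP.≟ x)

  count-isFixed : ∀ a → count (T? ∘ isFixed a) (allFin n) ≡ fixedPoints a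
  count-isFixed a = count-cong _ _
    ((λ {x} → Equivalence.to (T-does⇔ (reflect a x FinP.≟ x))) , (λ {x} → Equivalence.from (T-does⇔ (reflect a x FinP.≟ x))))
    (allFin n)

  private
    solutions : ℕ → ℕ → ℕ
    solutions A N = count (λ x → suc (toℕ x + toℕ x + A) ≟ N) (allFin n)

    fixedPoints≡ : ∀ a → fixedPoints a ≡ solutions (toℕ a) n + solutions (toℕ a) (n + n)
    fixedPoints≡ a = trans
      (count-cong _ (λ x → (suc (toℕ x + toℕ x + toℕ a) ≟ n) ⊎-dec (suc (toℕ x + toℕ x + toℕ a) ≟ n + n))
        ((λ {x} → Equivalence.to (reflect-fixed⇔ a x)) , (λ {x} → Equivalence.from (reflect-fixed⇔ a x))) (allFin n))
      (count-⊎ _ _ (λ x eq₁ eq₂ → n≢n+n (trans (sym eq₁) eq₂)) (allFin n))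
      where
      n≢n+n : n ≢ n + n
      n≢n+n eq = ≢-nonZero⁻¹ n (+-cancelˡ-≡ n n 0 (trans (sym eq) (sym (+-identityʳ n))))

    solutions-one : ∀ A N X₀ → X₀ < n → suc (X₀ + X₀ + A) ≡ N → solutions A N ≡ 1
    solutions-one A N X₀ X₀<n eq₀ =
      trans (count-cong _ (FinP._≟ fromℕ< X₀<n) (to , from) (allFin n)) (count-allFin-≡ (fromℕ< X₀<n))
      where
      to : ∀ {x} → suc (toℕ x + toℕ x + A) ≡ N → x ≡ fromℕ< X₀<n
      to eq = FinP.toℕ-injective
        (trans (double-injective (+-cancelʳ-≡ A _ _ (suc-injective (trans eq (sym eq₀))))) (sym (FinP.toℕ-fromℕ< X₀<n)))
      from : ∀ {x} → x ≡ fromℕ< X₀<n → suc (toℕ x + toℕ x + A) ≡ N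
      from refl = trans (cong (λ z → suc (z + z + A)) (FinP.toℕ-fromℕ< X₀<n)) eq₀

    solutions-none : ∀ A N → (∀ X → suc (X + X + A) ≢ N) → solutions A N ≡ 0
    solutions-none A N no-solution = count-none _ (allFin n) (λ x → no-solution (toℕ x))

    double-+-even : ∀ (X u : ℕ) → suc (X + X + (u + u)) ≡ suc ((X + u) + (X + u))
    double-+-even X u = cong (1 +_) (lemma X u)
      where
      lemma : ∀ (X u : ℕ) → X + X + (u + u) ≡ (X + u) + (X + u)
      lemma = solve-∀
    double-+-odd : ∀ (X u : ℕ) → suc (X + X + suc (u + u)) ≡ (X + suc u) + (X + suc u)
    double-+-odd = solve-∀

  fixedPoints-odd : ∀ h → n ≡ suc (h + h) → ∀ a → fixedPoints a ≡ 1
  fixedPoints-odd h n≡ a = trans (fixedPoints≡ a) (by-parity (even-or-odd A))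
    where
    A = toℕ a
    A<n : A < suc (h + h)
    A<n = subst (A <_) n≡ (FinP.toℕ<n a)
    by-parity : _ → solutions A n + solutions A (n + n) ≡ 1
    by-parity (inj₁ (u , A≡)) = cong₂ _+_ one none
      where
      u≤h : u ≤ h
      u≤h = half-monoˡ-≤ u h (≤-pred (subst (_< suc (h + h)) A≡ A<n))
      X₀ = h ∸ u
      one : solutions A n ≡ 1
      one = solutions-one A n X₀ (subst (X₀ <_) (sym n≡) (s≤s (≤-trans (m∸n≤m h u) (m≤m+n h h))))
        (trans (cong (λ z → suc (X₀ + X₀ + z)) A≡)
          (trans (double-+-even X₀ u) (trans (cong (λ z → suc (z + z)) (m∸n+n≡m u≤h)) (sym n≡))))
      none : solutions A (n + n) ≡ 0
      none = solutions-none A (n + n) (λ X eq → odd≢even (X + u) (suc (h + h))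
        (trans (sym (double-+-even X u)) (trans (cong (λ z → suc (X + X + z)) (sym A≡)) (trans eq (cong₂ _+_ n≡ n≡)))))
    by-parity (inj₂ (u , A≡)) = cong₂ _+_ none one
      where
      u<h : u < h
      u<h = half-mono-< u h (≤-pred (subst (_< suc (h + h)) A≡ A<n))
      X₀ = (h + h) ∸ u
      none : solutions A n ≡ 0
      none = solutions-none A n (λ X eq → odd≢even h (X + suc u)
        (sym (trans (sym (double-+-odd X u)) (trans (cong (λ z → suc (X + X + z)) (sym A≡)) (trans eq n≡)))))
      one : solutions A (n + n) ≡ 1
      one = solutions-one A (n + n) X₀ (subst (X₀ <_) (sym n≡) (s≤s (m∸n≤m (h + h) u)))
        (trans (cong (λ z → suc (X₀ + X₀ + z)) A≡) (trans (double-+-odd X₀ u)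
          (trans (cong (λ z → z + z) (trans (+-suc X₀ u) (cong suc (m∸n+n≡m (≤-trans (<⇒≤ u<h) (m≤m+n h h))))))
            (sym (cong₂ _+_ n≡ n≡)))))

  fixedPoints-even-even : ∀ h → n ≡ h + h → ∀ a u → toℕ a ≡ u + u → fixedPoints a ≡ 0
  fixedPoints-even-even h n≡ a u A≡ =
    trans (fixedPoints≡ a) (cong₂ _+_ (no-solution n h n≡) (no-solution (n + n) (h + h) (cong₂ _+_ n≡ n≡)))
    where
    no-solution : ∀ N k → N ≡ k + k → solutions (toℕ a) N ≡ 0
    no-solution N k N≡ = solutions-none (toℕ a) N (λ X eq → odd≢even (X + u) k
      (trans (sym (double-+-even X u)) (trans (cong (λ z → suc (X + X + z)) (sym A≡)) (trans eq N≡))))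

  fixedPoints-even-odd : ∀ h → n ≡ h + h → ∀ a u → toℕ a ≡ suc (u + u) → fixedPoints a ≡ 2
  fixedPoints-even-odd h n≡ a u A≡ =
    trans (fixedPoints≡ a) (cong₂ _+_
      (one-solution n h n≡ 1+u≤h (subst (h ≤_) (sym n≡) (m≤m+n h h)))
      (one-solution (n + n) (h + h) (cong₂ _+_ n≡ n≡) (≤-trans 1+u≤h (m≤m+n h h)) (≤-reflexive (sym n≡))))
    where
    1+u≤h : suc u ≤ h
    1+u≤h = half-monoˡ-≤ (suc u) h
      (subst (_≤ h + h) (cong suc (sym (+-suc u u))) (subst (_< h + h) A≡ (subst (toℕ a <_) n≡ (FinP.toℕ<n a))))
    one-solution : ∀ N k → N ≡ k + k → suc u ≤ k → k ≤ n → solutions (toℕ a) N ≡ 1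
    one-solution N k N≡ 1+u≤k k≤n = solutions-one (toℕ a) N X₀ (≤-trans X₀<k k≤n)
      (trans (cong (λ z → suc (X₀ + X₀ + z)) A≡)
        (trans (double-+-odd X₀ u) (trans (cong (λ z → z + z) X₀+1+u≡k) (sym N≡))))
      where
      X₀ = k ∸ suc u
      X₀+1+u≡k : X₀ + suc u ≡ k
      X₀+1+u≡k = m∸n+n≡m 1+u≤k
      X₀<k : X₀ < k
      X₀<k = subst (X₀ <_) X₀+1+u≡k (m<m+n X₀ (s≤s z≤n))

  order-nonZero : ∀ k → NonZero (order k)
  order-nonZero k = >-nonZero (order-positive k)

-- Elements of given order and Euler's totient

upTo≡map-toℕ-allFin : ∀ n → upTo n ≡ map toℕ (allFin n)
upTo≡map-toℕ-allFin n = trans (applyUpTo≡tabulate id n) (sym (ListP.map-tabulate id toℕ))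
  where
  applyUpTo≡tabulate : (f : ℕ → ℕ) → ∀ n → applyUpTo f n ≡ tabulate {n = n} (f ∘ toℕ)
  applyUpTo≡tabulate f zero = refl
  applyUpTo≡tabulate f (suc n) = cong (f 0 ∷_) (applyUpTo≡tabulate (f ∘ suc) n)

count-upTo-≡ : ∀ {n k} → k < n → count (_≟ k) (upTo n) ≡ 1
count-upTo-≡ {n} {k} k<n = begin
  count (_≟ k) (upTo n)                      ≡⟨ cong (count (_≟ k)) (upTo≡map-toℕ-allFin n) ⟩
  count (_≟ k) (map toℕ (allFin n))          ≡⟨ count-map (_≟ k) toℕ (allFin n) ⟩
  count ((_≟ k) ∘ toℕ) (allFin n)            ≡⟨ count-cong _ (FinP._≟ fromℕ< k<n) (to , from) (allFin n) ⟩
  count (FinP._≟ fromℕ< k<n) (allFin n)      ≡⟨ count-allFin-≡ (fromℕ< k<n) ⟩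
  1                                          ∎
  where
  open ≡-Reasoning
  to : ∀ {i} → toℕ i ≡ k → i ≡ fromℕ< k<n
  to eq = FinP.toℕ-injective (trans eq (sym (FinP.toℕ-fromℕ< k<n)))
  from : ∀ {i} → i ≡ fromℕ< k<n → toℕ i ≡ k
  from refl = FinP.toℕ-fromℕ< k<n

∈-divisors⁻ : ∀ {n d} → d ∈ divisors n → d ∣ n × 0 < d
∈-divisors⁻ {n} d∈ with ∈-filter⁻ (_∣? n) {xs = map suc (upTo n)} d∈
... | k∈ , d∣n with ∈-map⁻ suc k∈
...   | _ , _ , refl = d∣n , s≤s z≤n

count-divisors-≡ : ∀ n .{{_ : NonZero n}} {d} → d ∣ n → 0 < d → count (_≟ d) (divisors n) ≡ 1
count-divisors-≡ n {suc d} d∣n _ = begin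
  count (_≟ suc d) (filter (_∣? n) (map suc (upTo n)))
    ≡⟨ count-filter-⊆ (_≟ suc d) (_∣? n) (λ { refl → d∣n }) (map suc (upTo n)) ⟩
  count (_≟ suc d) (map suc (upTo n))
    ≡⟨ count-map (_≟ suc d) suc (upTo n) ⟩
  count ((_≟ suc d) ∘ suc) (upTo n)
    ≡⟨ count-cong _ (_≟ d) (suc-injective , cong suc) (upTo n) ⟩
  count (_≟ d) (upTo n)
    ≡⟨ count-upTo-≡ (∣⇒≤ d∣n) ⟩
  1 ∎
  where open ≡-Reasoning

module _ (n : ℕ) .{{_ : NonZero n}} where
  open ℤmod n

  private module Scaling {d e : ℕ} (n≡e*d : n ≡ e * d) (0<d : 0 < d) where

    instance
      d-nonZero : NonZero d
      d-nonZero = >-nonZero 0<d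
      e-nonZero : NonZero e
      e-nonZero = ≢-nonZero (λ e≡0 → ≢-nonZero⁻¹ n (trans n≡e*d (cong (_* d) e≡0)))

    n≡d*e : n ≡ d * e
    n≡d*e = trans n≡e*d (*-comm e d)

    scale : Fin d → Fin n
    scale i = fromℕ< (subst (toℕ i * e <_) (sym n≡d*e) (*-monoˡ-< e (FinP.toℕ<n i)))

    unscale : Fin n → Fin d
    unscale a = fromℕ< (m<n*o⇒m/o<n (subst (toℕ a <_) n≡d*e (FinP.toℕ<n a)))

    toℕ-scale : ∀ i → toℕ (scale i) ≡ toℕ i * e
    toℕ-scale i = FinP.toℕ-fromℕ< _

    toℕ-unscale : ∀ a → toℕ (unscale a) ≡ toℕ a / e
    toℕ-unscale a = FinP.toℕ-fromℕ< _

    unscale∘scale : ∀ i → unscale (scale i) ≡ i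
    unscale∘scale i = FinP.toℕ-injective (trans (toℕ-unscale (scale i)) (trans (cong (_/ e) (toℕ-scale i)) (m*n/n≡m (toℕ i) e)))

    order-scale : ∀ i → gcd (toℕ i) d ≡ 1 → order (toℕ (scale i)) ≡ d
    order-scale i unit = begin
      (n / gcd (toℕ (scale i)) n) {{gcd[-,n]-nonZero (toℕ (scale i))}}
        ≡⟨ /-congʳ {{gcd[-,n]-nonZero (toℕ (scale i))}} gcd≡e ⟩
      n / e                                                          ≡⟨ cong (_/ e) n≡d*e ⟩
      d * e / e                                                      ≡⟨ m*n/n≡m d e ⟩
      d                                                              ∎
      where
      open ≡-Reasoning
      gcd≡e : gcd (toℕ (scale i)) n ≡ e
      gcd≡e = begin
        gcd (toℕ (scale i)) n   ≡⟨ cong₂ gcd (trans (toℕ-scale i) (*-comm (toℕ i) e)) n≡e*d ⟩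
        gcd (e * toℕ i) (e * d) ≡⟨ c*gcd[m,n]≡gcd[cm,cn] e (toℕ i) d ⟨
        e * gcd (toℕ i) d       ≡⟨ cong (e *_) unit ⟩
        e * 1                   ≡⟨ *-identityʳ e ⟩
        e                       ∎

    module _ (a : Fin n) (order≡d : order (toℕ a) ≡ d) where

      private
        instance _ = gcd[-,n]-nonZero (toℕ a)
        gcd≡e : gcd (toℕ a) n ≡ e
        gcd≡e = *-cancelʳ-≡ _ e d
          (trans (trans (cong (gcd (toℕ a) n *_) (sym order≡d)) (m*[n/m]≡n (gcd[m,n]∣n (toℕ a) n))) n≡e*d)

      unit-unscale : gcd (toℕ (unscale a)) d ≡ 1
      unit-unscale = trans (cong₂ gcd (trans (toℕ-unscale a) (/-congʳ (sym gcd≡e))) (sym order≡d))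
                           (coprime⇒gcd≡1 (coprime-/gcd (toℕ a) n))

      scale∘unscale : scale (unscale a) ≡ a
      scale∘unscale = FinP.toℕ-injective (trans (toℕ-scale (unscale a)) (trans (cong (_* e) (toℕ-unscale a))
                        (m/n*n≡m (subst (_∣ toℕ a) gcd≡e (gcd[m,n]∣m (toℕ a) n)))))

  -- For n = e · d, i ↦ e · i is a bijection from the units of ℤ/d onto the elements of order d of ℤ/n.
  count-order≡φ : ∀ {d} → d ∣ n → 0 < d → count (λ a → order (toℕ a) ≟ d) (allFin n) ≡ φ d
  count-order≡φ {d} (divides e n≡e*d) 0<d = sym (begin
    φ d
      ≡⟨ cong (count (λ k → gcd k d ≟ 1)) (upTo≡map-toℕ-allFin d) ⟩
    count (λ k → gcd k d ≟ 1) (map toℕ (allFin d))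
      ≡⟨ count-map _ toℕ (allFin d) ⟩
    count unit? (allFin d)
      ≡⟨ CountBijection.count-≡ (decSetoid FinP._≟_) (decSetoid FinP._≟_) unit? order≡d?
           (λ { refl u → u }) (λ { refl o → o })
           (allFin d) (allFin n) (λ i _ → count-allFin-≡ i) (λ a _ → count-allFin-≡ a)
           scale unscale (cong scale) (cong unscale) order-scale unit-unscale (λ i _ → unscale∘scale i) scale∘unscale ⟩
    count order≡d? (allFin n) ∎)
    where
    open ≡-Reasoning
    open Scaling {d} {e} n≡e*d 0<d
    unit? : Decidable (λ (i : Fin d) → gcd (toℕ i) d ≡ 1)
    unit? i = gcd (toℕ i) d ≟ 1
    order≡d? : Decidable (λ (a : Fin n) → order (toℕ a) ≡ d)
    order≡d? a = order (toℕ a) ≟ d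

  sum-by-order : (G : ℕ → ℕ) → sum (map (λ a → G (order (toℕ a))) (allFin n)) ≡ Σ∣ n (λ d → φ d * G d)
  sum-by-order G = begin
    sum (map (λ a → G (order (toℕ a))) (allFin n))
      ≡⟨ sum-map-cong (λ a → sym (select a)) (allFin n) ⟩
    sum (map (λ a → sum (map (term a) (divisors n))) (allFin n))
      ≡⟨ sum-map-comm term (allFin n) (divisors n) ⟩
    sum (map (λ d → sum (map (λ a → term a d) (allFin n))) (divisors n))
      ≡⟨ sum-map-cong-∈ (divisors n) (λ d d∈ → trans
           (sum-map-indicator (λ a → order (toℕ a) ≟ d) (G d) (λ a → term a d)
              (λ a eq → if-dec-yes (order (toℕ a) ≟ d) eq) (λ a ne → if-dec-no (order (toℕ a) ≟ d) ne) (allFin n))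
           (cong (_* G d) (count-order≡φ (proj₁ (∈-divisors⁻ {n} d∈)) (proj₂ (∈-divisors⁻ {n} d∈))))) ⟩
    sum (map (λ d → φ d * G d) (divisors n)) ∎
    where
    open ≡-Reasoning
    term : Fin n → ℕ → ℕ
    term a d = if does (order (toℕ a) ≟ d) then G d else 0
    select : ∀ a → sum (map (term a) (divisors n)) ≡ G (order (toℕ a))
    select a = trans
      (sum-map-indicator (_≟ order (toℕ a)) (G (order (toℕ a))) (term a)
        (λ d d≡ → trans (if-dec-yes (order (toℕ a) ≟ d) (sym d≡)) (cong G d≡))
        (λ d d≢ → if-dec-no (order (toℕ a) ≟ d) (d≢ ∘ sym)) (divisors n))
      (trans (cong (_* G (order (toℕ a))) (count-divisors-≡ n (order-∣-n (toℕ a)) (order-positive (toℕ a)))) (+-identityʳ _))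

-- Orbit lengths of the symmetries and the fixed tilings

lcm-∣⇔ : ∀ a b k → lcm a b ∣ k ⇔ (a ∣ k × b ∣ k)
lcm-∣⇔ a b k = mk⇔ (λ l∣k → ∣-trans (m∣lcm[m,n] a b) l∣k , ∣-trans (n∣lcm[m,n] a b) l∣k) (uncurry lcm-least)

lcm-nonZero : ∀ a b .{{_ : NonZero a}} .{{_ : NonZero b}} → NonZero (lcm a b)
lcm-nonZero a b = ≢-nonZero λ lcm≡0 → ≢-nonZero⁻¹ (a * b) {{m*n≢0 a b}}
  (trans (sym (gcd*lcm a b)) (trans (cong (gcd a b *_) lcm≡0) (*-zeroʳ (gcd a b))))

iter-×-≡⇔ : (h : U → U) (h′ : V → V) (x : U) (y : V) → ∀ k →
  iter k (λ (u , v) → h u , h′ v) (x , y) ≡ (x , y) ⇔ (iter k h x ≡ x × iter k h′ y ≡ y)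
iter-×-≡⇔ h h′ x y k = mk⇔
  (λ eq → ProductP.×-≡,≡←≡ (trans (sym (iter-× h h′ k x y)) eq))
  (λ eqs → trans (iter-× h h′ k x y) (ProductP.×-≡,≡→≡ eqs))

involution-period : (h : U → U) → (∀ x → h (h x) ≡ x) → ∀ {x} (fixed? : Dec (h x ≡ x)) k →
  iter k h x ≡ x ⇔ (if does fixed? then 1 else 2) ∣ k
involution-period h h-involutive {x} (yes fix) k = mk⇔ (λ _ → 1∣ k)
  (λ _ → Equivalence.from (iter-involution-fixed h h-involutive x k) (inj₂ fix))
involution-period h h-involutive {x} (no ¬fix) k = mk⇔
  (λ it → [ id , (λ fix → ⊥-elim (¬fix fix)) ]′ (Equivalence.to (iter-involution-fixed h h-involutive x k) it))
  (λ 2∣k → Equivalence.from (iter-involution-fixed h h-involutive x k) (inj₁ 2∣k))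

involution×-period : (h : U → U) → (∀ x → h (h x) ≡ x) → ∀ {x} (fixed? : Dec (h x ≡ x)) (h′ : V → V) {y} d →
  (∀ k → iter k h′ y ≡ y ⇔ d ∣ k) →
  ∀ k → (iter k h x ≡ x × iter k h′ y ≡ y) ⇔ (if does fixed? then d else lcm 2 d) ∣ k
involution×-period h h-involutive {x} (yes fix) h′ d period-y k = mk⇔
  (λ (_ , it′) → Equivalence.to (period-y k) it′)
  (λ d∣k → Equivalence.from (iter-involution-fixed h h-involutive x k) (inj₂ fix) , Equivalence.from (period-y k) d∣k)
involution×-period h h-involutive {x} (no ¬fix) h′ d period-y k = ⇔.trans (mk⇔
  (λ (it , it′) → [ id , (λ fix → ⊥-elim (¬fix fix)) ]′ (Equivalence.to (iter-involution-fixed h h-involutive x k) it)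
                  , Equivalence.to (period-y k) it′)
  (λ (2∣k , d∣k) → Equivalence.from (iter-involution-fixed h h-involutive x k) (inj₁ 2∣k) , Equivalence.from (period-y k) d∣k))
  (⇔.sym (lcm-∣⇔ 2 d k))

involution²-period : (h : U → U) → (∀ x → h (h x) ≡ x) → ∀ {x} (fixed? : Dec (h x ≡ x)) →
  (h′ : V → V) → (∀ y → h′ (h′ y) ≡ y) → ∀ {y} (fixed′? : Dec (h′ y ≡ y)) →
  ∀ k → (iter k h x ≡ x × iter k h′ y ≡ y) ⇔ (if does fixed? ∧ does fixed′? then 1 else 2) ∣ k
involution²-period h h-involutive fixed? h′ h′-involutive fixed′? k =
  subst (λ L → _ ⇔ L ∣ k) (period≡ fixed? fixed′?)
        (involution×-period h h-involutive fixed? h′ _ (involution-period h′ h′-involutive fixed′?) k)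
  where
  period≡ : ∀ {P Q : Set} (P? : Dec P) (Q? : Dec Q) →
    (if does P? then (if does Q? then 1 else 2) else lcm 2 (if does Q? then 1 else 2)) ≡ (if does P? ∧ does Q? then 1 else 2)
  period≡ (yes _) (yes _) = refl
  period≡ (yes _) (no _) = refl
  period≡ (no _) (yes _) = refl
  period≡ (no _) (no _) = refl

module _ {R : Subgroup} (𝒯 : TileSet R) where

  act-cong : ∀ v {g h} → g ≡ h → (p : T (mem R g)) (q : T (mem R h)) → act 𝒯 v g p ≡ act 𝒯 v h q
  act-cong v refl p q = cong (act 𝒯 v _) (BoolP.T-irrelevant p q)

  iter-act : ∀ g (p : T (mem R g)) k v → iter k (λ v → act 𝒯 v g p) v ≡ act 𝒯 v (pow g k) (mem-pow R p k)
  iter-act g p zero v = sym (act-e 𝒯 v)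
  iter-act g p (suc k) v = begin
    iter (suc k) (λ v → act 𝒯 v g p) v         ≡⟨ iter-suc (λ v → act 𝒯 v g p) k v ⟩
    act 𝒯 (iter k (λ v → act 𝒯 v g p) v) g p   ≡⟨ cong (λ w → act 𝒯 w g p) (iter-act g p k v) ⟩
    act 𝒯 (act 𝒯 v (pow g k) (mem-pow R p k)) g p ≡⟨ act-∙ 𝒯 v (mem-pow R p k) p ⟨
    act 𝒯 v (pow g (suc k)) (mem-pow R p (suc k)) ∎
    where open ≡-Reasoning

  count-iter-act : ∀ g (p : T (mem R g)) k →
    count (λ v → iter k (λ v → act 𝒯 v g p) v FinP.≟ v) (allFin (size 𝒯)) ≡ tcount 𝒯 (pow g k) (mem-pow R p k)
  count-iter-act g p k =
    count-cong _ _ ((λ {v} eq → trans (sym (iter-act g p k v)) eq) , (λ {v} eq → trans (iter-act g p k v) eq)) (allFin (size 𝒯))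

  count-iter-act-involution : ∀ g (p : T (mem R g)) → g ∙ g ≡ e → ∀ {k} → 2 ∣ k →
    count (λ v → iter k (λ v → act 𝒯 v g p) v FinP.≟ v) (allFin (size 𝒯)) ≡ tcount 𝒯 e (mem-e R)
  count-iter-act-involution g p g∙g≡e 2∣k =
    count-cong _ _ ((λ {v} _ → act-e 𝒯 v) , (λ {v} _ → iter-∣-periodic (λ v → act 𝒯 v g p) (involutive v) 2∣k))
      (allFin (size 𝒯))
    where
    involutive : ∀ v → iter 2 (λ v → act 𝒯 v g p) v ≡ v
    involutive v = trans (sym (act-∙ 𝒯 v p p)) (trans (act-cong v g∙g≡e (mem-∙ R p p) (mem-e R)) (act-e 𝒯 v))

module FixedTilingCounts (n : ℕ) .{{_ : NonZero n}} {R : Subgroup} (𝒯 : TileSet R) where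
  open ℤmod n

  tₑ : ℕ
  tₑ = tcount 𝒯 e (mem-e R)

  fixCount-e : ∀ a b → fixCount n 𝒯 (a , b) e (mem-e R) ≡ tₑ ^ ((n * n) div lcm (order (toℕ a)) (order (toℕ b)))
  fixCount-e a b = begin
    fixCount n 𝒯 (a , b) e (mem-e R)
      ≡⟨ count-equivariant-two-classes α (λ _ → true) (λ _ → refl) L 1 (λ _ → refl) (fixed? n 𝒯 (a , b) e (mem-e R)) ⟩
    fixedTiles α L ^ (everywhere div L) * fixedTiles α 1 ^ ((n * n ∸ everywhere) div 1)
      ≡⟨ cong (λ k → fixedTiles α L ^ (k div L) * fixedTiles α 1 ^ ((n * n ∸ k) div 1)) everywhere≡ ⟩
    fixedTiles α L ^ ((n * n) div L) * fixedTiles α 1 ^ ((n * n ∸ n * n) div 1)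
      ≡⟨ cong₂ (λ t k → t ^ ((n * n) div L) * fixedTiles α 1 ^ (k div 1)) all-fixed (n∸n≡0 (n * n)) ⟩
    tₑ ^ ((n * n) div L) * 1
      ≡⟨ *-identityʳ _ ⟩
    tₑ ^ ((n * n) div L) ∎
    where
    open ≡-Reasoning
    L = lcm (order (toℕ a)) (order (toℕ b))
    instance
      L-nonZero : NonZero L
      L-nonZero = lcm-nonZero (order (toℕ a)) (order (toℕ b)) {{order-nonZero (toℕ a)}} {{order-nonZero (toℕ b)}}
    α : Fin (size 𝒯) → Fin (size 𝒯)
    α v = act 𝒯 v e (mem-e R)
    period-char : ∀ c k → iter k (λ c → actCellS n c (a , b) e) c ≡ c ⇔ L ∣ k
    period-char (x , y) k = ⇔.trans (iter-×-≡⇔ (translate a) (translate b) x y k)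
      (⇔.trans (iter-translate-≡⇔order-∣ a x k ×-⇔ iter-translate-≡⇔order-∣ b y k) (⇔.sym (lcm-∣⇔ _ _ k)))
    open EquivariantTilings n (λ c → actCellS n c (a , b) e) (λ _ → L) (λ _ → L-nonZero) period-char
    everywhere : ℕ
    everywhere = count (T? ∘ λ (_ : Cell n) → true) (allCells n)
    everywhere≡ : everywhere ≡ n * n
    everywhere≡ = trans (count-all _ (allCells n) (λ _ → tt)) (length-allCells n)
    all-fixed : fixedTiles α L ≡ tₑ
    all-fixed = count-cong _ _ ((λ {v} _ → act-e 𝒯 v) , (λ {v} _ → iter-∣-periodic α (act-e 𝒯 v) (1∣ L)))
      (allFin (size 𝒯))

  -- F mirror lines of n cells, on which orbits have length d; all other orbits have length lcm 2 d.
  tcount-pow : (g : D8) → T (mem R g) → ℕ → ℕ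
  tcount-pow g p d = tcount 𝒯 (pow g d) (mem-pow R p d)

  glideCount : (g : D8) → T (mem R g) → ℕ → ℕ → ℕ
  glideCount g p F d = tcount-pow g p d ^ ((F * n) div d) * tₑ ^ ((n * n ∸ F * n) div lcm 2 d)

  fixCount-glide : ∀ ab g (p : T (mem R g)) → g ∙ g ≡ e → (mirror : Cell n → Bool) →
    (∀ c → mirror (actCellS n c ab g) ≡ mirror c) → ∀ d {{_ : NonZero d}} →
    (∀ c k → iter k (λ c → actCellS n c ab g) c ≡ c ⇔ (if mirror c then d else lcm 2 d) ∣ k) →
    ∀ F → count (T? ∘ mirror) (allCells n) ≡ F * n → fixCount n 𝒯 ab g p ≡ glideCount g p F d
  fixCount-glide ab g p g∙g≡e mirror mirror-σ d period-char F mirrors≡ = begin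
    fixCount n 𝒯 ab g p
      ≡⟨ count-equivariant-two-classes α mirror mirror-σ d (lcm 2 d) (λ _ → refl) (fixed? n 𝒯 ab g p) ⟩
    fixedTiles α d ^ (count (T? ∘ mirror) (allCells n) div d)
      * fixedTiles α (lcm 2 d) ^ ((n * n ∸ count (T? ∘ mirror) (allCells n)) div lcm 2 d)
      ≡⟨ cong (λ k → fixedTiles α d ^ (k div d) * fixedTiles α (lcm 2 d) ^ ((n * n ∸ k) div lcm 2 d)) mirrors≡ ⟩
    fixedTiles α d ^ ((F * n) div d) * fixedTiles α (lcm 2 d) ^ ((n * n ∸ F * n) div lcm 2 d)
      ≡⟨ cong₂ (λ t t′ → t ^ ((F * n) div d) * t′ ^ ((n * n ∸ F * n) div lcm 2 d))
           (count-iter-act 𝒯 g p d) (count-iter-act-involution 𝒯 g p g∙g≡e (m∣lcm[m,n] 2 d)) ⟩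
    glideCount g p F d ∎
    where
    open ≡-Reasoning
    instance _ = lcm-nonZero 2 d
    period : Cell n → ℕ
    period c = if mirror c then d else lcm 2 d
    period-nonZero : ∀ c → NonZero (period c)
    period-nonZero c with mirror c
    ... | true = it
    ... | false = it
    α : Fin (size 𝒯) → Fin (size 𝒯)
    α v = act 𝒯 v g p
    open EquivariantTilings n (λ c → actCellS n c ab g) period period-nonZero period-char

  fixCount-f : ∀ a b (p : T (mem R f)) → fixCount n 𝒯 (a , b) f p ≡ glideCount f p (fixedPoints a) (order (toℕ b))
  fixCount-f a b p =
    fixCount-glide (a , b) f p refl (isFixed a ∘ proj₁) (λ (x , _) → isFixed-reflect a x) d {{order-nonZero (toℕ b)}}
      period-char (fixedPoints a) (trans (count-allCells-proj₁ n (isFixed a)) (cong (_* n) (count-isFixed a)))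
    where
    d = order (toℕ b)
    period-char : ∀ c k → iter k (λ c → actCellS n c (a , b) f) c ≡ c ⇔ (if isFixed a (proj₁ c) then d else lcm 2 d) ∣ k
    period-char (x , y) k = ⇔.trans (iter-×-≡⇔ (reflect a) (translate b) x y k)
      (involution×-period (reflect a) (reflect-involutive a) (reflect a x FinP.≟ x) (translate b) _
        (iter-translate-≡⇔order-∣ b y) k)

  fixCount-r²f : ∀ a b (p : T (mem R r²f)) → fixCount n 𝒯 (a , b) r²f p ≡ glideCount r²f p (fixedPoints b) (order (toℕ a))
  fixCount-r²f a b p =
    fixCount-glide (a , b) r²f p refl (isFixed b ∘ proj₂) (λ (_ , y) → isFixed-reflect b y) d {{order-nonZero (toℕ a)}}
      period-char (fixedPoints b) (trans (count-allCells-proj₂ n (isFixed b)) (trans (cong (n *_) (count-isFixed b)) (*-comm n _)))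
    where
    d = order (toℕ a)
    translate′ : Fin n → Fin n
    translate′ = opposite ∘ opposite ∘ translate a
    translate′-period : ∀ x k → iter k translate′ x ≡ x ⇔ d ∣ k
    translate′-period x k = ⇔.trans (mk⇔ (trans (sym (same k x))) (trans (same k x))) (iter-translate-≡⇔order-∣ a x k)
      where
      same : ∀ k x → iter k translate′ x ≡ iter k (translate a) x
      same = iter-cong (λ x → FinP.opposite-involutive (translate a x))
    period-char : ∀ c k → iter k (λ c → actCellS n c (a , b) r²f) c ≡ c ⇔ (if isFixed b (proj₂ c) then d else lcm 2 d) ∣ k
    period-char (x , y) k = ⇔.trans (iter-×-≡⇔ translate′ (reflect b) x y k)
      (⇔.trans (mk⇔ (λ (i , j) → j , i) (λ (j , i) → i , j))
        (involution×-period (reflect b) (reflect-involutive b) (reflect b y FinP.≟ y) translate′ _ (translate′-period x) k))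

  fixCount-r² : ∀ a b (p : T (mem R r²)) →
    fixCount n 𝒯 (a , b) r² p ≡ tcount 𝒯 r² p ^ ((fixedPoints a * fixedPoints b) div 1)
                                 * tₑ ^ ((n * n ∸ fixedPoints a * fixedPoints b) div 2)
  fixCount-r² a b p = begin
    fixCount n 𝒯 (a , b) r² p
      ≡⟨ count-equivariant-two-classes α centre centre-σ 1 2 (λ _ → refl) (fixed? n 𝒯 (a , b) r² p) ⟩
    fixedTiles α 1 ^ (count (T? ∘ centre) (allCells n) div 1) * fixedTiles α 2 ^ ((n * n ∸ count (T? ∘ centre) (allCells n)) div 2)
      ≡⟨ cong₂ (λ k t → fixedTiles α 1 ^ (k div 1) * t ^ ((n * n ∸ k) div 2))
               centres≡ (count-iter-act-involution 𝒯 r² p refl ∣-refl) ⟩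
    tcount 𝒯 r² p ^ ((fixedPoints a * fixedPoints b) div 1) * tₑ ^ ((n * n ∸ fixedPoints a * fixedPoints b) div 2) ∎
    where
    open ≡-Reasoning
    centre : Cell n → Bool
    centre (x , y) = isFixed a x ∧ isFixed b y
    centre-σ : ∀ c → centre (actCellS n c (a , b) r²) ≡ centre c
    centre-σ (x , y) = cong₂ _∧_ (isFixed-reflect a x) (isFixed-reflect b y)
    period : Cell n → ℕ
    period c = if centre c then 1 else 2
    period-nonZero : ∀ c → NonZero (period c)
    period-nonZero c with centre c
    ... | true = it
    ... | false = it
    period-char : ∀ c k → iter k (λ c → actCellS n c (a , b) r²) c ≡ c ⇔ period c ∣ k
    period-char (x , y) k = ⇔.trans (iter-×-≡⇔ (reflect a) (reflect b) x y k)
      (involution²-period (reflect a) (reflect-involutive a) (reflect a x FinP.≟ x)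
                          (reflect b) (reflect-involutive b) (reflect b y FinP.≟ y) k)
    α : Fin (size 𝒯) → Fin (size 𝒯)
    α v = act 𝒯 v r² p
    open EquivariantTilings n (λ c → actCellS n c (a , b) r²) period period-nonZero period-char
    centres≡ : count (T? ∘ centre) (allCells n) ≡ fixedPoints a * fixedPoints b
    centres≡ = trans (count-allCells-∧ n (isFixed a) (isFixed b)) (cong₂ _*_ (count-isFixed a) (count-isFixed b))

-- Summing over the translations

sum-applyUpTo-2-periodic : (g : ℕ → ℕ) → (∀ k → g (suc (suc k)) ≡ g k) → ∀ h →
  sum (applyUpTo g (h + h)) ≡ h * (g 0 + g 1)
sum-applyUpTo-2-periodic g periodic zero = refl
sum-applyUpTo-2-periodic g periodic (suc h) = begin
  sum (applyUpTo g (suc h + suc h))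
    ≡⟨ cong (sum ∘ applyUpTo g ∘ suc) (+-suc h h) ⟩
  g 0 + (g 1 + sum (applyUpTo (λ k → g (2 + k)) (h + h)))
    ≡⟨ cong (λ s → g 0 + (g 1 + s)) (sum-applyUpTo-2-periodic (λ k → g (2 + k)) (λ k → periodic (2 + k)) h) ⟩
  g 0 + (g 1 + h * (g 2 + g 3))
    ≡⟨ cong (λ s → g 0 + (g 1 + h * s)) (cong₂ _+_ (periodic 0) (periodic 1)) ⟩
  g 0 + (g 1 + h * (g 0 + g 1))
    ≡⟨ distribute (g 0) (g 1) h ⟩
  suc h * (g 0 + g 1) ∎
  where
  open ≡-Reasoning
  distribute : ∀ x y h → x + (y + h * (x + y)) ≡ suc h * (x + y)
  distribute = solve-∀

odd-form : ∀ {n} → ¬ 2 ∣ n → ∃ λ h → n ≡ suc (h + h)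
odd-form {n} 2∤n with even-or-odd n
... | inj₁ (h , n≡) = ⊥-elim (2∤n (subst (2 ∣_) (sym n≡) (2∣h+h h)))
... | inj₂ odd = odd

even-form : ∀ {n} → 2 ∣ n → ∃ λ h → n ≡ h + h
even-form {n} 2∣n with even-or-odd n
... | inj₁ even = even
... | inj₂ (h , n≡) = ⊥-elim (¬2∣odd h (subst (2 ∣_) n≡ 2∣n))

module _ (n : ℕ) .{{_ : NonZero n}} where
  open ℤmod n

  sum-allFin-const : ∀ c → sum (map (λ (_ : Fin n) → c) (allFin n)) ≡ n * c
  sum-allFin-const c = trans (sum-map-const c (allFin n)) (cong (_* c) (length-allFin n))

  sum-fixedPoints-odd : ¬ 2 ∣ n → ∀ (G : ℕ → ℕ) → sum (map (G ∘ fixedPoints) (allFin n)) ≡ n * G 1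
  sum-fixedPoints-odd 2∤n G = let (h , n≡) = odd-form 2∤n in
    trans (sum-map-cong (λ a → cong G (fixedPoints-odd h n≡ a)) (allFin n)) (sum-allFin-const (G 1))

  -- For even n, reflect a has no fixed point when a is even and two when a is odd.
  sum-fixedPoints-even : ∀ h → n ≡ h + h → ∀ (G : ℕ → ℕ) → sum (map (G ∘ fixedPoints) (allFin n)) ≡ h * (G 0 + G 2)
  sum-fixedPoints-even h n≡ G = begin
    sum (map (G ∘ fixedPoints) (allFin n))        ≡⟨ sum-map-cong (λ a → cong G (fixedPoints≡parity a)) (allFin n) ⟩
    sum (map (g ∘ toℕ) (allFin n))                 ≡⟨ cong sum (ListP.map-∘ (allFin n)) ⟩
    sum (map g (map toℕ (allFin n)))               ≡⟨ cong (sum ∘ map g) (upTo≡map-toℕ-allFin n) ⟨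
    sum (map g (upTo n))                           ≡⟨ cong sum (ListP.map-upTo g n) ⟩
    sum (applyUpTo g n)                  ≡⟨ cong (sum ∘ applyUpTo g) n≡ ⟩
    sum (applyUpTo g (h + h))            ≡⟨ sum-applyUpTo-2-periodic g g-periodic h ⟩
    h * (G 0 + G 2)                                ∎
    where
    open ≡-Reasoning
    parityPoints : ℕ → ℕ
    parityPoints k = if does (2 ∣? k) then 0 else 2
    g = G ∘ parityPoints
    fixedPoints≡parity : ∀ a → fixedPoints a ≡ parityPoints (toℕ a)
    fixedPoints≡parity a with even-or-odd (toℕ a)
    ... | inj₁ (u , a≡) =
      trans (fixedPoints-even-even h n≡ a u a≡) (sym (if-dec-yes (2 ∣? toℕ a) (subst (2 ∣_) (sym a≡) (2∣h+h u))))
    ... | inj₂ (u , a≡) =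
      trans (fixedPoints-even-odd h n≡ a u a≡) (sym (if-dec-no (2 ∣? toℕ a) (¬2∣odd u ∘ subst (2 ∣_) a≡)))
    g-periodic : ∀ k → g (suc (suc k)) ≡ g k
    g-periodic k = cong (λ b → G (if b then 0 else 2))
      (does-⇔ (mk⇔ (λ 2∣2+k → ∣m+n∣m⇒∣n 2∣2+k ∣-refl) (∣m∣n⇒∣m+n ∣-refl)) (2 ∣? suc (suc k)) (2 ∣? k))

module FixSqFormulas (n : ℕ) .{{_ : NonZero n}} {R : Subgroup} (𝒯 : TileSet R) where
  open ℤmod n
  open FixedTilingCounts n 𝒯

  FixSq-e : FixSq n 𝒯 e (mem-e R) ≡ Σ∣ n (λ d₁ → Σ∣ n (λ d₂ → φ d₁ * φ d₂ * tₑ ^ ((n * n) div lcm d₁ d₂)))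
  FixSq-e = begin
    FixSq n 𝒯 e (mem-e R)
      ≡⟨ sum-map-cong (λ a → sum-map-cong (λ b → fixCount-e a b) (allFin n)) (allFin n) ⟩
    sum (map (λ a → sum (map (λ b → G (order (toℕ a)) (order (toℕ b))) (allFin n))) (allFin n))
      ≡⟨ sum-map-cong (λ a → sum-by-order n (G (order (toℕ a)))) (allFin n) ⟩
    sum (map (λ a → Σ∣ n (λ d₂ → φ d₂ * G (order (toℕ a)) d₂)) (allFin n))
      ≡⟨ sum-by-order n (λ d₁ → Σ∣ n (λ d₂ → φ d₂ * G d₁ d₂)) ⟩
    Σ∣ n (λ d₁ → φ d₁ * Σ∣ n (λ d₂ → φ d₂ * G d₁ d₂))
      ≡⟨ sum-map-cong (λ d₁ → trans (sym (sum-map-*ˡ (φ d₁) _ (divisors n)))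
                                    (sum-map-cong (λ d₂ → sym (*-assoc (φ d₁) (φ d₂) _)) (divisors n))) (divisors n) ⟩
    Σ∣ n (λ d₁ → Σ∣ n (λ d₂ → φ d₁ * φ d₂ * G d₁ d₂)) ∎
    where
    open ≡-Reasoning
    G : ℕ → ℕ → ℕ
    G d₁ d₂ = tₑ ^ ((n * n) div lcm d₁ d₂)

  module _ (p : T (mem R r²)) where

    private
      centreCount : ℕ → ℕ
      centreCount k = tcount 𝒯 r² p ^ (k div 1) * tₑ ^ ((n * n ∸ k) div 2)

      FixSq-r²≡ : FixSq n 𝒯 r² p
                  ≡ sum (map (λ a → sum (map (λ b → centreCount (fixedPoints a * fixedPoints b)) (allFin n))) (allFin n))
      FixSq-r²≡ = sum-map-cong (λ a → sum-map-cong (λ b → fixCount-r² a b p) (allFin n)) (allFin n)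

    FixSq-r²-odd : ¬ 2 ∣ n → FixSq n 𝒯 r² p ≡ n * n * (tₑ ^ ((n * n ∸ 1) div 2) * tcount 𝒯 r² p)
    FixSq-r²-odd 2∤n = begin
      FixSq n 𝒯 r² p
        ≡⟨ FixSq-r²≡ ⟩
      sum (map (λ a → sum (map (λ b → centreCount (fixedPoints a * fixedPoints b)) (allFin n))) (allFin n))
        ≡⟨ sum-map-cong (λ a → sum-fixedPoints-odd n 2∤n (λ F → centreCount (fixedPoints a * F))) (allFin n) ⟩
      sum (map (λ a → n * centreCount (fixedPoints a * 1)) (allFin n))
        ≡⟨ sum-fixedPoints-odd n 2∤n (λ F → n * centreCount (F * 1)) ⟩
      n * (n * centreCount 1)
        ≡⟨ *-assoc n n _ ⟨
      n * n * (tcount 𝒯 r² p ^ 1 * tₑ ^ ((n * n ∸ 1) div 2))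
        ≡⟨ cong (n * n *_) (trans (cong (_* tₑ ^ ((n * n ∸ 1) div 2)) (*-identityʳ (tcount 𝒯 r² p)))
                                  (*-comm (tcount 𝒯 r² p) (tₑ ^ ((n * n ∸ 1) div 2)))) ⟩
      n * n * (tₑ ^ ((n * n ∸ 1) div 2) * tcount 𝒯 r² p) ∎
      where open ≡-Reasoning

    FixSq-r²-even : 2 ∣ n →
      4 * FixSq n 𝒯 r² p ≡ n * n * (3 * tₑ ^ ((n * n) div 2) + tₑ ^ ((n * n) div 2 ∸ 2) * tcount 𝒯 r² p ^ 4)
    FixSq-r²-even 2∣n = begin
      4 * FixSq n 𝒯 r² p
        ≡⟨ cong (4 *_) FixSq-r²≡ ⟩
      4 * sum (map (λ a → sum (map (λ b → centreCount (fixedPoints a * fixedPoints b)) (allFin n))) (allFin n))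
        ≡⟨ cong (4 *_) (sum-map-cong (λ a → sum-fixedPoints-even n h n≡ (λ F → centreCount (fixedPoints a * F))) (allFin n)) ⟩
      4 * sum (map (λ a → h * (centreCount (fixedPoints a * 0) + centreCount (fixedPoints a * 2))) (allFin n))
        ≡⟨ cong (4 *_) (sum-fixedPoints-even n h n≡ (λ F → h * (centreCount (F * 0) + centreCount (F * 2)))) ⟩
      4 * (h * (h * (C₀ + C₀) + h * (C₀ + C₄)))
        ≡⟨ expand h C₀ C₄ ⟩
      (h + h) * (h + h) * (3 * C₀ + C₄)
        ≡⟨ cong (λ m → m * m * (3 * C₀ + C₄)) n≡ ⟨
      n * n * (3 * C₀ + C₄)
        ≡⟨ cong₂ (λ c₀ c₄ → n * n * (3 * c₀ + c₄)) (*-identityˡ (tₑ ^ ((n * n) div 2))) C₄≡ ⟩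
      n * n * (3 * tₑ ^ ((n * n) div 2) + tₑ ^ ((n * n) div 2 ∸ 2) * tcount 𝒯 r² p ^ 4) ∎
      where
      open ≡-Reasoning
      h : ℕ
      h = proj₁ (even-form 2∣n)
      n≡ : n ≡ h + h
      n≡ = proj₂ (even-form 2∣n)
      C₀ = centreCount 0
      C₄ = centreCount 4
      expand : ∀ h c₀ c₄ → 4 * (h * (h * (c₀ + c₀) + h * (c₀ + c₄))) ≡ (h + h) * (h + h) * (3 * c₀ + c₄)
      expand = solve-∀
      C₄≡ : C₄ ≡ tₑ ^ ((n * n) div 2 ∸ 2) * tcount 𝒯 r² p ^ 4
      C₄≡ = trans (*-comm (tcount 𝒯 r² p ^ 4) _)
                  (cong (λ k → tₑ ^ k * tcount 𝒯 r² p ^ 4) ([m∸n*o]/o≡m/o∸n (n * n) 2 2))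

  module _ (g : D8) (p : T (mem R g)) where

    glideSum : ℕ
    glideSum = sum (map (λ a → sum (map (λ b → glideCount g p (fixedPoints a) (order (toℕ b))) (allFin n))) (allFin n))

    private
      glideSum≡ : glideSum ≡ sum (map ((λ F → Σ∣ n (λ d → φ d * glideCount g p F d)) ∘ fixedPoints) (allFin n))
      glideSum≡ = sum-map-cong (λ a → sum-by-order n (glideCount g p (fixedPoints a))) (allFin n)

    glideSum-odd : ¬ 2 ∣ n →
      glideSum ≡ n * Σ∣ n (λ d → φ d * (tₑ ^ ((n * n ∸ n) div lcm 2 d) * tcount-pow g p d ^ (n div d)))
    glideSum-odd 2∤n = begin
      glideSum                                         ≡⟨ glideSum≡ ⟩
      sum (map ((λ F → Σ∣ n (λ d → φ d * glideCount g p F d)) ∘ fixedPoints) (allFin n))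
        ≡⟨ sum-fixedPoints-odd n 2∤n (λ F → Σ∣ n (λ d → φ d * glideCount g p F d)) ⟩
      n * Σ∣ n (λ d → φ d * glideCount g p 1 d)
        ≡⟨ cong (n *_) (sum-map-cong (λ d → cong (φ d *_) (one-mirror d)) (divisors n)) ⟩
      n * Σ∣ n (λ d → φ d * (tₑ ^ ((n * n ∸ n) div lcm 2 d) * tcount-pow g p d ^ (n div d))) ∎
      where
      open ≡-Reasoning
      one-mirror : ∀ d → glideCount g p 1 d ≡ tₑ ^ ((n * n ∸ n) div lcm 2 d) * tcount-pow g p d ^ (n div d)
      one-mirror d = trans (cong (λ k → tcount-pow g p d ^ (k div d) * tₑ ^ ((n * n ∸ k) div lcm 2 d)) (*-identityˡ n))
                           (*-comm (tcount-pow g p d ^ (n div d)) _)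

    glideSum-even : 2 ∣ n →
      2 * glideSum ≡ n * Σ∣ n (λ d → φ d * (tₑ ^ ((n * n) div lcm 2 d)
                                            + tₑ ^ ((n * n ∸ 2 * n) div lcm 2 d) * tcount-pow g p d ^ ((2 * n) div d)))
    glideSum-even 2∣n = begin
      2 * glideSum                                     ≡⟨ cong (2 *_) glideSum≡ ⟩
      2 * sum (map (H ∘ fixedPoints) (allFin n))       ≡⟨ cong (2 *_) (sum-fixedPoints-even n h n≡ H) ⟩
      2 * (h * (H 0 + H 2))                            ≡⟨ *-assoc 2 h _ ⟨
      2 * h * (H 0 + H 2)                              ≡⟨ cong (_* (H 0 + H 2)) (trans (cong (h +_) (+-identityʳ h)) (sym n≡)) ⟩
      n * (H 0 + H 2)
        ≡⟨ cong (n *_) (sum-map-+ (λ d → φ d * glideCount g p 0 d) (λ d → φ d * glideCount g p 2 d) (divisors n)) ⟨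
      n * Σ∣ n (λ d → φ d * glideCount g p 0 d + φ d * glideCount g p 2 d)
        ≡⟨ cong (n *_) (sum-map-cong (λ d → trans (sym (*-distribˡ-+ (φ d) _ _))
                                                   (cong (φ d *_) (cong₂ _+_ (no-mirror d) (two-mirrors d)))) (divisors n)) ⟩
      n * Σ∣ n (λ d → φ d * (tₑ ^ ((n * n) div lcm 2 d)
                            + tₑ ^ ((n * n ∸ 2 * n) div lcm 2 d) * tcount-pow g p d ^ ((2 * n) div d))) ∎
      where
      open ≡-Reasoning
      h : ℕ
      h = proj₁ (even-form 2∣n)
      n≡ : n ≡ h + h
      n≡ = proj₂ (even-form 2∣n)
      H : ℕ → ℕ
      H F = Σ∣ n (λ d → φ d * glideCount g p F d)
      0-div : ∀ d → 0 div d ≡ 0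
      0-div zero = refl
      0-div (suc d) = refl
      no-mirror : ∀ d → glideCount g p 0 d ≡ tₑ ^ ((n * n) div lcm 2 d)
      no-mirror d = trans (cong (λ k → tcount-pow g p d ^ k * tₑ ^ ((n * n) div lcm 2 d)) (0-div d))
                          (*-identityˡ _)
      two-mirrors : ∀ d → glideCount g p 2 d ≡ tₑ ^ ((n * n ∸ 2 * n) div lcm 2 d) * tcount-pow g p d ^ ((2 * n) div d)
      two-mirrors d = *-comm (tcount-pow g p d ^ ((2 * n) div d)) _

  FixSq-f : (p : T (mem R f)) → FixSq n 𝒯 f p ≡ glideSum f p
  FixSq-f p = sum-map-cong (λ a → sum-map-cong (λ b → fixCount-f a b p) (allFin n)) (allFin n)

  FixSq-r²f : (p : T (mem R r²f)) → FixSq n 𝒯 r²f p ≡ glideSum r²f p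
  FixSq-r²f p = trans (sum-map-cong (λ a → sum-map-cong (λ b → fixCount-r²f a b p) (allFin n)) (allFin n))
                      (sum-map-comm (λ a b → glideCount r²f p (fixedPoints b) (order (toℕ a))) (allFin n) (allFin n))

mainTheorem14 : (n : ℕ) .{{_ : NonZero n}} (R : Subgroup) (𝒯 : TileSet R) →
  (FixSq n 𝒯 e (mem-e R)
     ≡ Σ∣ n (λ d₁ → Σ∣ n (λ d₂ →
         φ d₁ * φ d₂ * tcount 𝒯 e (mem-e R) ^ ((n * n) div lcm d₁ d₂))))
  × ((p : T (mem R r²)) →
      (¬ (2 ∣ n) →
        FixSq n 𝒯 r² p
          ≡ n * n * (tcount 𝒯 e (mem-e R) ^ ((n * n ∸ 1) div 2) * tcount 𝒯 r² p))
      × (2 ∣ n →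
        4 * FixSq n 𝒯 r² p
          ≡ n * n * (3 * tcount 𝒯 e (mem-e R) ^ ((n * n) div 2)
                     + tcount 𝒯 e (mem-e R) ^ ((n * n) div 2 ∸ 2) * tcount 𝒯 r² p ^ 4)))
  × ((p : T (mem R f)) →
      (2 ∣ n →
        2 * FixSq n 𝒯 f p
          ≡ n * Σ∣ n (λ d → φ d *
              (tcount 𝒯 e (mem-e R) ^ ((n * n) div lcm 2 d)
               + tcount 𝒯 e (mem-e R) ^ ((n * n ∸ 2 * n) div lcm 2 d)
                 * tcount 𝒯 (pow f d) (mem-pow R p d) ^ ((2 * n) div d))))
      × (¬ (2 ∣ n) →
        FixSq n 𝒯 f p
          ≡ n * Σ∣ n (λ d → φ d *
              (tcount 𝒯 e (mem-e R) ^ ((n * n ∸ n) div lcm 2 d)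
               * tcount 𝒯 (pow f d) (mem-pow R p d) ^ (n div d)))))
  × ((p : T (mem R r²f)) →
      (2 ∣ n →
        2 * FixSq n 𝒯 r²f p
          ≡ n * Σ∣ n (λ d → φ d *
              (tcount 𝒯 e (mem-e R) ^ ((n * n) div lcm 2 d)
               + tcount 𝒯 e (mem-e R) ^ ((n * n ∸ 2 * n) div lcm 2 d)
                 * tcount 𝒯 (pow r²f d) (mem-pow R p d) ^ ((2 * n) div d))))
      × (¬ (2 ∣ n) →
        FixSq n 𝒯 r²f p
          ≡ n * Σ∣ n (λ d → φ d *
              (tcount 𝒯 e (mem-e R) ^ ((n * n ∸ n) div lcm 2 d)
               * tcount 𝒯 (pow r²f d) (mem-pow R p d) ^ (n div d)))))
mainTheorem14 n R 𝒯 =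
    FixSq-e
  , (λ p → FixSq-r²-odd p , FixSq-r²-even p)
  , (λ p → (λ 2∣n → trans (cong (2 *_) (FixSq-f p)) (glideSum-even f p 2∣n))
         , (λ 2∤n → trans (FixSq-f p) (glideSum-odd f p 2∤n)))
  , (λ p → (λ 2∣n → trans (cong (2 *_) (FixSq-r²f p)) (glideSum-even r²f p 2∣n))
         , (λ 2∤n → trans (FixSq-r²f p) (glideSum-odd r²f p 2∤n)))
  where open FixSqFormulas n 𝒯
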